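{- Let $\lambda=(\lambda_1,\ldots,\lambda_s)$ be a partition of $k$ with $s\ge2$, and let $\lambda'=(\lambda_1,\ldots,\lambda_{s-1})$, a partition of $k-\lambda_s$. Then for every $i$, $$h_i(K_\lambda)=\sum_{j=0}^{\lambda_s}\binom{k-\lambda_s-i+j}{j}\binom{i+\lambda_s-j}{\lambda_s-j}h_{i-j}(K_{\lambda'}).$$
   Context: For $m\ge1$, $C_m$ is the chain $0<1<\cdots<m$. For a partition $\lambda=(\lambda_1,\ldots,\lambda_s)$ of $k$, $P_\lambda=C_{\lambda_1}\times\cdots\times C_{\lambda_s}$ and $K_\lambda=\Delta(P_\lambda\setminus\{\hat0,\hat1\})$ (order complex of the proper part), a $(k-2)$-dimensional complex. For a $d$-dimensional simplicial complex $K$ with $f_{i}$ faces of dimension $i$ ($f_{ -1}=1$), the $h$-vector is $(h_0,\ldots,h_{d+1})$ with $h_s=\sum_{i=0}^{s}(-1)^{s-i}\binom{d+1-i}{d+1-s}f_{i-1}$; entries $h_m$ with $m<0$ or $m>d+1$ are taken to be $0$. -}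

module Defs where

open import Data.Bool using (Bool; true; false; _∧_; _∨_; not; if_then_else_)
open import Data.Nat using (ℕ; zero; suc; _+_; _∸_; _≤_; _≤ᵇ_; _≡ᵇ_)
open import Data.Nat.Combinatorics using (_C_)
open import Data.Integer as ℤ using (ℤ; +_; -_; _^_)
open import Data.List using (List; []; _∷_; map; concatMap; upTo; filter; length; foldr; _++_)
open import Data.Nat.ListAction using (sum)
open import Data.List.Relation.Unary.All using (All)
open import Data.List.Relation.Binary.Pointwise using (Pointwise)
open import Relation.Nullary.Decidable using (Dec; yes; no)
open import Relation.Binary.PropositionalEquality using (_≡_)

data Decreasing : List ℕ → Set where
  dec-[]  : Decreasing []
  dec-[x] : ∀ {x} → Decreasing (x ∷ [])
  dec-∷   : ∀ {x y ys} → y ≤ x → Decreasing (y ∷ ys) → Decreasing (x ∷ y ∷ ys)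

IsPartitionOf : List ℕ → ℕ → Set
IsPartitionOf lam k = All (1 ≤_) lam × Decreasing lam × sum lam ≡ k
  where open import Data.Product using (_×_)

-- The poset P_λ = C_{λ₁} × ⋯ × C_{λ_s}: elements are lists (x₁,…,x_s)
-- with 0 ≤ x_j ≤ λ_j, ordered componentwise.

box : List ℕ → List (List ℕ)
box []       = [] ∷ []
box (m ∷ ms) = concatMap (λ a → map (a ∷_) (box ms)) (upTo (suc m))

leqᵇ : List ℕ → List ℕ → Bool
leqᵇ []       []       = true
leqᵇ (x ∷ xs) (y ∷ ys) = (x ≤ᵇ y) ∧ leqᵇ xs ys
leqᵇ _        _        = false

eqᵇ : List ℕ → List ℕ → Bool
eqᵇ []       []       = true
eqᵇ (x ∷ xs) (y ∷ ys) = (x ≡ᵇ y) ∧ eqᵇ xs ys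
eqᵇ _        _        = false

comparableᵇ : List ℕ → List ℕ → Bool
comparableᵇ x y = leqᵇ x y ∨ leqᵇ y x

zeros : List ℕ → List ℕ
zeros = map (λ _ → 0)

properPart : List ℕ → List (List ℕ)
properPart lam = filter (T? ∘ (λ x → not (eqᵇ x (zeros lam)) ∧ not (eqᵇ x lam))) (box lam)
  where
  open import Data.Bool.Properties using (T?)
  open import Function using (_∘_)


-- Order complex: faces are the chains (totally ordered subsets),
-- including the empty face. Subsets of the (duplicate-free) element
-- list are enumerated as sublists.

sublists : {A : Set} → List A → List (List A)
sublists []       = [] ∷ []
sublists (x ∷ xs) = map (x ∷_) (sublists xs) ++ sublists xs

allᵇ : {A : Set} → (A → Bool) → List A → Bool
allᵇ p = foldr (λ a b → p a ∧ b) true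

isChainᵇ : List (List ℕ) → Bool
isChainᵇ []       = true
isChainᵇ (x ∷ xs) = allᵇ (comparableᵇ x) xs ∧ isChainᵇ xs

faces : List ℕ → List (List (List ℕ))
faces lam = filter (T? ∘ isChainᵇ) (sublists (properPart lam))
  where
  open import Data.Bool.Properties using (T?)
  open import Function using (_∘_)

-- fK lam i = number of faces of K_λ with i vertices, i.e. f_{i-1}(K_λ)
fK : List ℕ → ℕ → ℕ
fK lam i = length (filter′ (λ σ → length σ ≡ᵇ i) (faces lam))
  where
  open import Data.Bool.Properties using (T?)
  open import Function using (_∘_)
  filter′ : {A : Set} → (A → Bool) → List A → List A
  filter′ p = filter (T? ∘ p)

-- h-vector. For a complex of dimension d, with n = d + 1 and
-- f i = f_{i-1}:  h_s = Σ_{i=0}^{s} (-1)^{s-i} C(n-i, n-s) f_{i-1}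
-- for 0 ≤ s ≤ n, and h_s = 0 for s > n.

Σ≤ : ℕ → (ℕ → ℤ) → ℤ
Σ≤ m g = foldr (λ j acc → g j ℤ.+ acc) (+ 0) (upTo (suc m))

hvec : (n : ℕ) → (ℕ → ℕ) → ℕ → ℤ
hvec n f s = if s ≤ᵇ n
  then Σ≤ s (λ i → ((- (+ 1)) ^ (s ∸ i)) ℤ.* (+ ((n ∸ i) C (n ∸ s))) ℤ.* (+ f i))
  else + 0

-- h_s(K_λ); K_λ has dimension k-2 where k = |λ|, so n = d+1 = k-1
hK : List ℕ → ℕ → ℤ
hK lam = hvec (sum lam ∸ 1) (fK lam)

{-# OPTIONS --safe #-}
-- Let Z_μ(m) be the number of multichains 0̂ ≤ x₁ ≤ ⋯ ≤ x_m ≤ 1̂ in P_μ and k = |μ|.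
-- Counted coordinatewise, Z_μ(m) = ∏ⱼ C(μⱼ + m, m). Counted by the chain of proper
-- elements they visit, Z_μ(m) = ∑ᵢ C(m + 1, i + 1) f_{i−1}(K_μ), which in terms of the
-- h-vector is the coefficient of tᵐ in h(t) / (1 − t)ᵏ⁺¹. Appending the part λₛ thus
-- multiplies these coefficients by C(λₛ + m, λₛ), and a Vandermonde-type identity shows
-- that the convolution in the statement has exactly this effect. As h ↦ h(t) / (1 − t)ᵏ⁺¹
-- is unitriangular, the two h-vectors agree.
module Submission where

open import Algebra.Bundles using (CommutativeSemiring)

module Summation {c ℓ} (R : CommutativeSemiring c ℓ) where

  open import Data.Bool.Base using (if_then_else_)
  open import Data.Nat.Base as ℕ using (ℕ; zero; suc; z<s; s<s; _<_; _≤ᵇ_; _<ᵇ_)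
  open import Data.Nat.Properties using (m≤n+m; _<?_; ≤⇒≯)
  open import Function using (_∘_)
  open import Relation.Nullary.Decidable using (dec-true; dec-false)
  open import Relation.Binary.PropositionalEquality as ≡ using (_≡_; cong)

  open CommutativeSemiring R
  open import Algebra.Properties.CommutativeSemigroup +-commutativeSemigroup using (interchange)
  open import Relation.Binary.Reasoning.Setoid setoid

  ∑ : ℕ → (ℕ → Carrier) → Carrier
  ∑ zero    f = 0#
  ∑ (suc n) f = f 0 + ∑ n (f ∘ suc)

  ∑-cong< : ∀ n {f g : ℕ → Carrier} → (∀ {i} → i < n → f i ≈ g i) → ∑ n f ≈ ∑ n g
  ∑-cong< zero    f≈g = refl
  ∑-cong< (suc n) f≈g = +-cong (f≈g z<s) (∑-cong< n (f≈g ∘ s<s))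

  ∑-cong : ∀ n {f g : ℕ → Carrier} → (∀ i → f i ≈ g i) → ∑ n f ≈ ∑ n g
  ∑-cong n f≈g = ∑-cong< n (λ {i} _ → f≈g i)

  ∑-zero : ∀ n {f : ℕ → Carrier} → (∀ {i} → i < n → f i ≈ 0#) → ∑ n f ≈ 0#
  ∑-zero zero    f≈0 = refl
  ∑-zero (suc n) f≈0 = trans (+-cong (f≈0 z<s) (∑-zero n (f≈0 ∘ s<s))) (+-identityˡ 0#)

  ∑-head : ∀ n (f : ℕ → Carrier) → (∀ {i} → i < n → f (suc i) ≈ 0#) → ∑ (suc n) f ≈ f 0
  ∑-head n f tail≈0 = trans (+-congˡ (∑-zero n tail≈0)) (+-identityʳ _)

  ∑-distrib-+ : ∀ n (f g : ℕ → Carrier) → ∑ n (λ i → f i + g i) ≈ ∑ n f + ∑ n g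
  ∑-distrib-+ zero    f g = sym (+-identityˡ 0#)
  ∑-distrib-+ (suc n) f g =
    trans (+-congˡ (∑-distrib-+ n (f ∘ suc) (g ∘ suc))) (interchange _ _ _ _)

  ∑-init-last : ∀ n (f : ℕ → Carrier) → ∑ (suc n) f ≈ ∑ n f + f n
  ∑-init-last zero    f = trans (+-identityʳ (f 0)) (sym (+-identityˡ (f 0)))
  ∑-init-last (suc n) f = trans (+-congˡ (∑-init-last n (f ∘ suc))) (sym (+-assoc _ _ _))

  ∑-++ : ∀ m n (f : ℕ → Carrier) → ∑ (m ℕ.+ n) f ≈ ∑ m f + ∑ n (λ t → f (m ℕ.+ t))
  ∑-++ zero    n f = sym (+-identityˡ _)
  ∑-++ (suc m) n f = trans (+-congˡ (∑-++ m n (f ∘ suc))) (sym (+-assoc _ _ _))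

  ∑-extend : ∀ m n (f : ℕ → Carrier) → (∀ {t} → t < n → f (m ℕ.+ t) ≈ 0#) →
             ∑ (m ℕ.+ n) f ≈ ∑ m f
  ∑-extend m n f tail≈0 = trans (∑-++ m n f) (trans (+-congˡ (∑-zero n tail≈0)) (+-identityʳ _))

  ∑-dropInit : ∀ m n (f : ℕ → Carrier) → (∀ {t} → t < m → f t ≈ 0#) →
               ∑ (m ℕ.+ n) f ≈ ∑ n (λ t → f (m ℕ.+ t))
  ∑-dropInit m n f init≈0 = trans (∑-++ m n f) (trans (+-congʳ (∑-zero m init≈0)) (+-identityˡ _))

  ∑-comm : ∀ m n (f : ℕ → ℕ → Carrier) →
           ∑ m (λ i → ∑ n (f i)) ≈ ∑ n (λ j → ∑ m (λ i → f i j))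
  ∑-comm zero    n f = sym (∑-zero n (λ _ → refl))
  ∑-comm (suc m) n f = begin
    ∑ n (f 0) + ∑ m (λ i → ∑ n (f (suc i)))        ≈⟨ +-congˡ (∑-comm m n (f ∘ suc)) ⟩
    ∑ n (f 0) + ∑ n (λ j → ∑ m (λ i → f (suc i) j)) ≈⟨ ∑-distrib-+ n (f 0) _ ⟨
    ∑ n (λ j → ∑ (suc m) (λ i → f i j))             ∎

  *-distribˡ-∑ : ∀ n x (f : ℕ → Carrier) → x * ∑ n f ≈ ∑ n (λ i → x * f i)
  *-distribˡ-∑ zero    x f = zeroʳ x
  *-distribˡ-∑ (suc n) x f = trans (distribˡ x _ _) (+-congˡ (*-distribˡ-∑ n x (f ∘ suc)))

  *-distribʳ-∑ : ∀ n x (f : ℕ → Carrier) → ∑ n f * x ≈ ∑ n (λ i → f i * x)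
  *-distribʳ-∑ zero    x f = zeroˡ x
  *-distribʳ-∑ (suc n) x f = trans (distribʳ x _ _) (+-congˡ (*-distribʳ-∑ n x (f ∘ suc)))

  ∑-shift : ∀ n j (g : ℕ → Carrier) →
    ∑ n (λ i → if j ≤ᵇ i then g i else 0#) ≈ ∑ n (λ s → if j ℕ.+ s <ᵇ n then g (j ℕ.+ s) else 0#)
  ∑-shift zero    j       g = refl
  ∑-shift (suc n) zero    g = +-congˡ (∑-cong< n (λ {i} i<n →
    reflexive (cong (λ b → if b then g (suc i) else 0#) (≡.sym (dec-true (i <? n) i<n)))))
  ∑-shift (suc n) (suc j) g = begin
    0# + ∑ n (λ i → if j <ᵇ suc i then g (suc i) else 0#) ≈⟨ +-identityˡ _ ⟩
    ∑ n (λ i → if j <ᵇ suc i then g (suc i) else 0#)      ≈⟨ ∑-cong n (λ i → reflexive (cong (λ b → if b then g (suc i) else 0#) (<ᵇ-suc j i))) ⟩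
    ∑ n (λ i → if j ≤ᵇ i then g (suc i) else 0#)          ≈⟨ ∑-shift n j (g ∘ suc) ⟩
    ∑ n F                                                  ≈⟨ +-identityʳ _ ⟨
    ∑ n F + 0#                                             ≈⟨ +-congˡ (reflexive F[n]≡0) ⟨
    ∑ n F + F n                                            ≈⟨ ∑-init-last n F ⟨
    ∑ (suc n) F                                            ∎
    where
    F = λ s → if j ℕ.+ s <ᵇ n then g (suc (j ℕ.+ s)) else 0#
    <ᵇ-suc : ∀ j i → (j <ᵇ suc i) ≡ (j ≤ᵇ i)
    <ᵇ-suc zero    i = ≡.refl
    <ᵇ-suc (suc j) i = ≡.refl
    F[n]≡0 : F n ≡ 0#
    F[n]≡0 = cong (λ b → if b then g (suc (j ℕ.+ n)) else 0#) (dec-false (j ℕ.+ n <? n) (≤⇒≯ (m≤n+m n j)))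

module Binomial where

  open import Data.Nat.Base
  open import Data.Nat.Properties
  open import Data.Nat.Combinatorics using (_C_; nCk+nC[k+1]≡[n+1]C[k+1]; nCk≡nC[n∸k])
  open import Data.Nat.Tactic.RingSolver using (solve-∀)
  open import Data.Bool.Base using (if_then_else_)
  open import Data.Bool.Properties using (if-cong)
  open import Function using (_∘_)
  open import Relation.Nullary.Decidable using (yes; no; dec-true; dec-false)
  open import Relation.Binary.PropositionalEquality
  open Summation +-*-commutativeSemiring
  open import Algebra.Properties.CommutativeSemigroup +-commutativeSemigroup using (x∙yz≈xz∙y)
  open ≡-Reasoning

  -- Unlike _C_, which divides factorials, binom has Pascal's rule as its
  -- defining equation.
  binom : ℕ → ℕ → ℕ
  binom n       zero    = 1
  binom zero    (suc k) = 0
  binom (suc n) (suc k) = binom n k + binom n (suc k)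

  C≡binom : ∀ n k → n C k ≡ binom n k
  C≡binom n       zero    = refl
  C≡binom zero    (suc k) = refl
  C≡binom (suc n) (suc k) = trans (sym (nCk+nC[k+1]≡[n+1]C[k+1] n k))
                                  (cong₂ _+_ (C≡binom n k) (C≡binom n (suc k)))

  binom-< : ∀ {n k} → n < k → binom n k ≡ 0
  binom-< {zero}  {suc k} _         = refl
  binom-< {suc n} {suc k} (s<s n<k) = cong₂ _+_ (binom-< n<k) (binom-< (m<n⇒m<1+n n<k))

  binom-diag : ∀ n → binom n n ≡ 1
  binom-diag zero    = refl
  binom-diag (suc n) = cong₂ _+_ (binom-diag n) (binom-< (n<1+n n))

  binom-sym : ∀ {n k} → k ≤ n → binom n (n ∸ k) ≡ binom n k
  binom-sym {n} {k} k≤n = begin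
    binom n (n ∸ k) ≡⟨ C≡binom n (n ∸ k) ⟨
    n C (n ∸ k)     ≡⟨ nCk≡nC[n∸k] k≤n ⟨
    n C k           ≡⟨ C≡binom n k ⟩
    binom n k       ∎

  binom-factorial : ∀ a b → binom (a + b) a * (a ! * b !) ≡ (a + b) !
  binom-factorial zero    b       = trans (+-identityʳ _) (+-identityʳ (b !))
  binom-factorial (suc a) zero    = begin
    binom (suc a + 0) (suc a) * (suc a ! * 1) ≡⟨ cong (λ n → binom n (suc a) * (suc a ! * 1)) (+-identityʳ (suc a)) ⟩
    binom (suc a) (suc a) * (suc a ! * 1)     ≡⟨ cong (_* (suc a ! * 1)) (binom-diag (suc a)) ⟩
    1 * (suc a ! * 1)                         ≡⟨ trans (*-identityˡ _) (*-identityʳ _) ⟩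
    suc a !                                   ≡⟨ cong _! (+-identityʳ (suc a)) ⟨
    (suc a + 0) !                             ∎
  binom-factorial (suc a) (suc b) = begin
    (binom (a + suc b) a + binom (a + suc b) (suc a)) * (suc a ! * suc b !)
      ≡⟨ cong (λ n → (x + binom n (suc a)) * (suc a ! * suc b !)) (+-suc a b) ⟩
    (x + y) * (suc a * a ! * (suc b * b !))
      ≡⟨ regroup x y (a !) (b !) a b ⟩
    suc a * (x * (a ! * suc b !)) + suc b * (y * (suc a ! * b !))
      ≡⟨ cong₂ (λ p q → suc a * p + suc b * q) (binom-factorial a (suc b)) (binom-factorial (suc a) b) ⟩
    suc a * (a + suc b) ! + suc b * (suc a + b) !
      ≡⟨ cong (λ n → suc a * n ! + suc b * (suc a + b) !) (+-suc a b) ⟩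
    suc a * (suc a + b) ! + suc b * (suc a + b) !
      ≡⟨ *-distribʳ-+ ((suc a + b) !) (suc a) (suc b) ⟨
    (suc a + suc b) * (suc a + b) !
      ≡⟨ cong (λ n → (suc a + suc b) * n !) (+-suc a b) ⟨
    (suc a + suc b) ! ∎
    where
    x = binom (a + suc b) a
    y = binom (suc a + b) (suc a)
    regroup : ∀ x y p q a b → (x + y) * (suc a * p * (suc b * q))
                            ≡ suc a * (x * (p * (suc b * q))) + suc b * (y * (suc a * p * q))
    regroup = solve-∀

  -- Both sides count the ways to choose disjoint c- and d-subsets of a
  -- (u + c + d)-set; multiplied by c! d! u! both equal (c + d + u)!.
  binom-subset-of-subset : ∀ c d u →
    binom (c + d) c * binom (u + (c + d)) (c + d) ≡ binom (u + d) d * binom (u + (c + d)) c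
  binom-subset-of-subset c d u = *-cancelʳ-≡ _ _ (c ! * (d ! * u !)) {{factorials≢0}}
    (trans (viaCD c d u) (sym (viaDU c d u)))
    where
    factorials≢0 : NonZero (c ! * (d ! * u !))
    factorials≢0 = m*n≢0 (c !) (d ! * u !) {{c !≢0}} {{d !* u !≢0}}
    viaCD : ∀ c d u → binom (c + d) c * binom (u + (c + d)) (c + d) * (c ! * (d ! * u !)) ≡ (c + (d + u)) !
    viaCD c d u = begin
      binom (c + d) c * binom (u + (c + d)) (c + d) * (c ! * (d ! * u !))
        ≡⟨ cong (λ n → binom (c + d) c * binom n (c + d) * (c ! * (d ! * u !))) (+-comm u (c + d)) ⟩
      binom (c + d) c * y * (c ! * (d ! * u !))
        ≡⟨ regroup (binom (c + d) c) y (c !) (d !) (u !) ⟩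
      y * ((binom (c + d) c * (c ! * d !)) * u !)
        ≡⟨ cong (λ n → y * (n * u !)) (binom-factorial c d) ⟩
      y * ((c + d) ! * u !)
        ≡⟨ binom-factorial (c + d) u ⟩
      ((c + d) + u) !
        ≡⟨ cong _! (+-assoc c d u) ⟩
      (c + (d + u)) ! ∎
      where
      y = binom ((c + d) + u) (c + d)
      regroup : ∀ x y p q r → x * y * (p * (q * r)) ≡ y * ((x * (p * q)) * r)
      regroup = solve-∀
    viaDU : ∀ c d u → binom (u + d) d * binom (u + (c + d)) c * (c ! * (d ! * u !)) ≡ (c + (d + u)) !
    viaDU c d u = begin
      binom (u + d) d * binom (u + (c + d)) c * (c ! * (d ! * u !))
        ≡⟨ cong₂ (λ m n → binom m d * binom n c * (c ! * (d ! * u !)))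
                 (+-comm u d) (trans (+-comm u (c + d)) (+-assoc c d u)) ⟩
      binom (d + u) d * y * (c ! * (d ! * u !))
        ≡⟨ regroup (binom (d + u) d) y (c !) (d !) (u !) ⟩
      y * (c ! * (binom (d + u) d * (d ! * u !)))
        ≡⟨ cong (λ n → y * (c ! * n)) (binom-factorial d u) ⟩
      y * (c ! * (d + u) !)
        ≡⟨ binom-factorial c (d + u) ⟩
      (c + (d + u)) ! ∎
      where
      y = binom (c + (d + u)) c
      regroup : ∀ x y p q r → x * y * (p * (q * r)) ≡ y * (p * (x * (q * r)))
      regroup = solve-∀

  hockey-stick : ∀ c m → ∑ (suc c) (λ a → binom (c ∸ a + m) m) ≡ binom (c + suc m) (suc m)
  hockey-stick zero    m = trans (+-identityʳ _) (trans (binom-diag m) (sym (binom-diag (suc m))))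
  hockey-stick (suc c) m = cong₂ _+_ (cong (λ n → binom n m) (sym (+-suc c m))) (hockey-stick c m)

  ∑-pascal : ∀ a c (x : ℕ → ℕ) → ∑ (suc c) (λ j → binom (suc a) j * x j)
             ≡ ∑ (suc c) (λ j → binom a j * x j) + ∑ c (λ j → binom a j * x (suc j))
  ∑-pascal a c x = begin
    1 * x 0 + ∑ c (λ j → (binom a j + binom a (suc j)) * x (suc j))
      ≡⟨ cong (1 * x 0 +_) (trans (∑-cong c (λ j → *-distribʳ-+ (x (suc j)) (binom a j) _))
                                  (∑-distrib-+ c (λ j → binom a j * x (suc j)) _)) ⟩
    1 * x 0 + (∑ c (λ j → binom a j * x (suc j)) + ∑ c (λ j → binom a (suc j) * x (suc j)))
      ≡⟨ x∙yz≈xz∙y (1 * x 0) _ _ ⟩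
    ∑ (suc c) (λ j → binom a j * x j) + ∑ c (λ j → binom a j * x (suc j)) ∎

  expansionTerm : ℕ → ℕ → ℕ → ℕ → ℕ → ℕ
  expansionTerm a c d u j = binom a j * (binom (c + d) (c ∸ j) * binom (u + (a + c + d) ∸ j) (a + c + d))

  expansion : ℕ → ℕ → ℕ → ℕ → ℕ
  expansion a c d u = ∑ (suc c) (expansionTerm a c d u)

  binomProduct : ℕ → ℕ → ℕ → ℕ → ℕ
  binomProduct a c d u = binom (u + (a + d)) (a + d) * binom (u + (c + d)) c

  -- the term of Pascal's recursion for expansion that moves one unit from c to d
  shiftedDown : (ℕ → ℕ → ℕ → ℕ → ℕ) → ℕ → ℕ → ℕ → ℕ → ℕ
  shiftedDown F a zero    d u = 0
  shiftedDown F a (suc c) d u = F a c (suc d) u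

  expansion-pascal : ∀ a c d u → expansion (suc a) c d (suc u)
    ≡ expansion a c d (suc u) + shiftedDown expansion a c d u + expansion (suc a) c d u
  expansion-pascal a c d u = begin
    ∑ (suc c) (λ j → binom (suc a) j * (B j * binom (suc u + suc N ∸ j) (suc N)))
      ≡⟨ ∑-cong< (suc c) (λ j<1+c → termSplit (≤-pred j<1+c)) ⟩
    ∑ (suc c) (λ j → binom (suc a) j * Y j + binom (suc a) j * T j)
      ≡⟨ ∑-distrib-+ (suc c) (λ j → binom (suc a) j * Y j) (λ j → binom (suc a) j * T j) ⟩
    ∑ (suc c) (λ j → binom (suc a) j * Y j) + expansion (suc a) c d u
      ≡⟨ cong (_+ expansion (suc a) c d u) (∑-pascal a c Y) ⟩
    expansion a c d (suc u) + ∑ c (λ j → binom a j * Y (suc j)) + expansion (suc a) c d u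
      ≡⟨ cong (λ s → expansion a c d (suc u) + s + expansion (suc a) c d u) (shifted c refl) ⟩
    expansion a c d (suc u) + shiftedDown expansion a c d u + expansion (suc a) c d u ∎
    where
    N = a + c + d
    B = λ j → binom (c + d) (c ∸ j)
    Y = λ j → B j * binom (suc u + N ∸ j) N
    T = λ j → B j * binom (u + suc N ∸ j) (suc N)
    termSplit : ∀ {j} → j ≤ c → binom (suc a) j * (B j * binom (suc u + suc N ∸ j) (suc N))
                               ≡ binom (suc a) j * Y j + binom (suc a) j * T j
    termSplit {j} j≤c = begin
      binom (suc a) j * (B j * binom (suc (u + suc N) ∸ j) (suc N))
        ≡⟨ cong (λ n → binom (suc a) j * (B j * binom n (suc N))) (+-∸-assoc 1 j≤u+1+N) ⟩
      binom (suc a) j * (B j * (binom (u + suc N ∸ j) N + binom (u + suc N ∸ j) (suc N)))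
        ≡⟨ cong (λ n → binom (suc a) j * (B j * (binom (n ∸ j) N + binom (u + suc N ∸ j) (suc N)))) (+-suc u N) ⟩
      binom (suc a) j * (B j * (binom (suc u + N ∸ j) N + binom (u + suc N ∸ j) (suc N)))
        ≡⟨ cong (binom (suc a) j *_) (*-distribˡ-+ (B j) _ _) ⟩
      binom (suc a) j * (Y j + T j)
        ≡⟨ *-distribˡ-+ (binom (suc a) j) (Y j) (T j) ⟩
      binom (suc a) j * Y j + binom (suc a) j * T j ∎
      where
      j≤u+1+N : j ≤ u + suc N
      j≤u+1+N = ≤-trans j≤c (≤-trans (≤-trans (m≤n+m c a) (m≤m+n (a + c) d)) (≤-trans (n≤1+n N) (m≤n+m (suc N) u)))
    shifted : ∀ c′ → c′ ≡ c → ∑ c (λ j → binom a j * Y (suc j)) ≡ shiftedDown expansion a c d u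
    shifted zero     refl = refl
    shifted (suc c′) refl = cong₂ (λ b M → ∑ (suc c′) (λ j → binom a j * (binom b (c′ ∸ j) * binom (u + M ∸ j) M)))
                                  (sym (+-suc c′ d)) (trans (cong (_+ d) (+-suc a c′)) (sym (+-suc (a + c′) d)))

  binomProduct-pascal : ∀ a c d u → binomProduct (suc a) c d (suc u)
    ≡ binomProduct a c d (suc u) + shiftedDown binomProduct a c d u + binomProduct (suc a) c d u
  binomProduct-pascal a zero d u = begin
    binom (suc u + suc (a + d)) (suc (a + d)) * 1 ≡⟨ cong (_* 1) top ⟩
    (P₁ + P₂) * 1       ≡⟨ *-distribʳ-+ 1 P₁ P₂ ⟩
    P₁ * 1 + P₂ * 1     ≡⟨ cong (_+ P₂ * 1) (+-identityʳ (P₁ * 1)) ⟨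
    P₁ * 1 + 0 + P₂ * 1 ∎
    where
    P₁ = binom (suc u + (a + d)) (a + d)
    P₂ = binom (u + suc (a + d)) (suc (a + d))
    top : binom (suc u + suc (a + d)) (suc (a + d)) ≡ P₁ + P₂
    top = cong (λ n → binom n (a + d) + P₂) (+-suc u (a + d))
  binomProduct-pascal a (suc c) d u = begin
    binom (suc u + suc p) (suc p) * binom (suc u + q) (suc c)
      ≡⟨ cong (_* (z + w)) top ⟩
    (P₁ + P₂) * (z + w)
      ≡⟨ regroup P₁ P₂ z w ⟩
    P₁ * (z + w) + P₂ * z + P₂ * w
      ≡⟨ cong₂ (λ m n → P₁ * (z + w) + binom (u + m) m * binom (u + n) c + P₂ * w)
               (+-suc a d) (+-suc c d) ⟨
    binomProduct a (suc c) d (suc u) + binomProduct a c (suc d) u + binomProduct (suc a) (suc c) d u ∎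
    where
    p = a + d
    q = suc c + d
    P₁ = binom (suc u + p) p
    P₂ = binom (u + suc p) (suc p)
    z = binom (u + q) c
    w = binom (u + q) (suc c)
    top : binom (suc u + suc p) (suc p) ≡ P₁ + P₂
    top = cong (λ n → binom n p + P₂) (+-suc u p)
    regroup : ∀ x y z w → (x + y) * (z + w) ≡ x * (z + w) + y * z + y * w
    regroup = solve-∀

  expansion≡binomProduct : ∀ a c d u → expansion a c d u ≡ binomProduct a c d u
  expansion≡binomProduct zero c d u = begin
    expansion zero c d u                            ≡⟨ ∑-head c (expansionTerm zero c d u) (λ _ → refl) ⟩
    1 * (binom (c + d) c * binom (u + (c + d)) (c + d)) ≡⟨ *-identityˡ _ ⟩
    binom (c + d) c * binom (u + (c + d)) (c + d)   ≡⟨ binom-subset-of-subset c d u ⟩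
    binomProduct zero c d u                         ∎
  expansion≡binomProduct (suc a) c d zero = begin
    expansion (suc a) c d zero                                   ≡⟨ ∑-head c (expansionTerm (suc a) c d zero) tail≡0 ⟩
    1 * (binom (c + d) c * binom (suc a + c + d) (suc a + c + d)) ≡⟨ cong (λ n → 1 * (binom (c + d) c * n)) (binom-diag (suc a + c + d)) ⟩
    1 * (binom (c + d) c * 1)                                    ≡⟨ trans (*-identityˡ _) (*-comm _ 1) ⟩
    1 * binom (c + d) c                                          ≡⟨ cong (_* binom (c + d) c) (binom-diag (suc a + d)) ⟨
    binomProduct (suc a) c d zero                                ∎
    where
    N = a + c + d
    tail≡0 : ∀ {j} → j < c → binom (suc a) (suc j) * (binom (c + d) (c ∸ suc j) * binom (N ∸ j) (suc N)) ≡ 0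
    tail≡0 {j} _ = begin
      binom (suc a) (suc j) * (binom (c + d) (c ∸ suc j) * binom (N ∸ j) (suc N))
        ≡⟨ cong (λ n → binom (suc a) (suc j) * (binom (c + d) (c ∸ suc j) * n)) (binom-< (s≤s (m∸n≤m N j))) ⟩
      binom (suc a) (suc j) * (binom (c + d) (c ∸ suc j) * 0)
        ≡⟨ trans (cong (binom (suc a) (suc j) *_) (*-zeroʳ (binom (c + d) (c ∸ suc j)))) (*-zeroʳ (binom (suc a) (suc j))) ⟩
      0 ∎
  expansion≡binomProduct (suc a) c d (suc u) = begin
    expansion (suc a) c d (suc u)
      ≡⟨ expansion-pascal a c d u ⟩
    expansion a c d (suc u) + shiftedDown expansion a c d u + expansion (suc a) c d u
      ≡⟨ cong₂ _+_ (cong₂ _+_ (expansion≡binomProduct a c d (suc u)) (shifted c))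
                   (expansion≡binomProduct (suc a) c d u) ⟩
    binomProduct a c d (suc u) + shiftedDown binomProduct a c d u + binomProduct (suc a) c d u
      ≡⟨ binomProduct-pascal a c d u ⟨
    binomProduct (suc a) c d (suc u) ∎
    where
    shifted : ∀ c → shiftedDown expansion a c d u ≡ shiftedDown binomProduct a c d u
    shifted zero    = refl
    shifted (suc c) = expansion≡binomProduct a c (suc d) u

  m+n∸o<n : ∀ {m n o} → m < o → 0 < n → m + n ∸ o < n
  m+n∸o<n {m} {suc n} m<o _ = s≤s (≤-trans (∸-monoʳ-≤ (m + suc n) m<o)
                                           (≤-reflexive (trans (cong (_∸ suc m) (+-suc m n)) (m+n∸m≡n m n))))

  -- The weight with which a s enters the j-th summand of zetaTransform (k′ + l) (hConvolution k′ l a) m.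
  convolutionCoeff : ℕ → ℕ → ℕ → ℕ → ℕ → ℕ
  convolutionCoeff k′ l m s j =
    if j + s <ᵇ suc m
      then binom (m ∸ (j + s) + (k′ + l)) (k′ + l) * (binom (k′ + j ∸ (j + s)) j * binom (j + s + l ∸ j) (l ∸ j))
      else 0

  convolutionCoeff≡expansionTerm : ∀ k′ l m {s} → s < k′ → s ≤ m →
    ∀ j → convolutionCoeff k′ l m s j ≡ expansionTerm (k′ ∸ s) l s (m ∸ s) j
  convolutionCoeff≡expansionTerm k′ l m {s} s<k′ s≤m j with j + s ≤? m
  ... | yes j+s≤m = begin
    convolutionCoeff k′ l m s j
      ≡⟨ if-cong (dec-true (j + s <? suc m) (s≤s j+s≤m)) ⟩
    binom (m ∸ (j + s) + K) K * (binom (k′ + j ∸ (j + s)) j * binom (j + s + l ∸ j) (l ∸ j))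
      ≡⟨ cong₂ (λ x y → binom x K * (binom y j * binom (j + s + l ∸ j) (l ∸ j))) m∸[j+s]+K≡u+K∸j k′+j∸[j+s]≡a ⟩
    binom (u + K ∸ j) K * (binom a j * binom (j + s + l ∸ j) (l ∸ j))
      ≡⟨ cong (λ z → binom (u + K ∸ j) K * (binom a j * binom z (l ∸ j))) j+s+l∸j≡l+s ⟩
    binom (u + K ∸ j) K * (binom a j * binom (l + s) (l ∸ j))
      ≡⟨ cong (λ N → binom (u + N ∸ j) N * (binom a j * binom (l + s) (l ∸ j))) a+l+s≡K ⟨
    binom (u + (a + l + s) ∸ j) (a + l + s) * (binom a j * binom (l + s) (l ∸ j))
      ≡⟨ x∙yz≈y∙zx (binom (u + (a + l + s) ∸ j) (a + l + s)) (binom a j) (binom (l + s) (l ∸ j)) ⟩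
    expansionTerm a l s u j ∎
    where
    open import Algebra.Properties.CommutativeSemigroup *-commutativeSemigroup using (x∙yz≈y∙zx)
    a = k′ ∸ s
    u = m ∸ s
    K = k′ + l
    a+l+s≡K : a + l + s ≡ K
    a+l+s≡K = begin
      a + l + s   ≡⟨ +-assoc a l s ⟩
      a + (l + s) ≡⟨ cong (a +_) (+-comm l s) ⟩
      a + (s + l) ≡⟨ +-assoc a s l ⟨
      a + s + l   ≡⟨ cong (_+ l) (m∸n+n≡m (<⇒≤ s<k′)) ⟩
      k′ + l      ∎
    k′+j∸[j+s]≡a : k′ + j ∸ (j + s) ≡ a
    k′+j∸[j+s]≡a = trans (cong (_∸ (j + s)) (+-comm k′ j)) ([m+n]∸[m+o]≡n∸o j k′ s)
    j+s+l∸j≡l+s : j + s + l ∸ j ≡ l + s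
    j+s+l∸j≡l+s = trans (cong (_∸ j) (+-assoc j s l)) (trans (m+n∸m≡n j (s + l)) (+-comm s l))
    m∸[j+s]+K≡u+K∸j : m ∸ (j + s) + K ≡ u + K ∸ j
    m∸[j+s]+K≡u+K∸j = begin
      m ∸ (j + s) + K ≡⟨ cong (λ x → m ∸ x + K) (+-comm j s) ⟩
      m ∸ (s + j) + K ≡⟨ cong (_+ K) (∸-+-assoc m s j) ⟨
      u ∸ j + K       ≡⟨ +-∸-comm K (≤-trans (≤-reflexive (sym (m+n∸n≡m j s))) (∸-monoˡ-≤ s j+s≤m)) ⟨
      u + K ∸ j       ∎
  ... | no  j+s≰m = begin
    convolutionCoeff k′ l m s j
      ≡⟨ if-cong (dec-false (j + s <? suc m) (j+s≰m ∘ ≤-pred)) ⟩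
    0
      ≡⟨ trans (cong (λ x → binom a j * (binom (l + s) (l ∸ j) * x)) (binom-< u+N∸j<N))
               (trans (cong (binom a j *_) (*-zeroʳ (binom (l + s) (l ∸ j)))) (*-zeroʳ (binom a j))) ⟨
    expansionTerm a l s u j ∎
    where
    a = k′ ∸ s
    u = m ∸ s
    u<j : u < j
    u<j = ≤-trans (≤-reflexive (sym (+-∸-assoc 1 s≤m))) (≤-trans (∸-monoˡ-≤ s (≰⇒> j+s≰m)) (≤-reflexive (m+n∸n≡m j s)))
    u+N∸j<N : u + (a + l + s) ∸ j < a + l + s
    u+N∸j<N = m+n∸o<n u<j (≤-trans (m<n⇒0<n∸m s<k′) (≤-trans (m≤m+n a l) (m≤m+n (a + l) s)))

  ∑-convolutionCoeff : ∀ k′ l m {s} → s < k′ → s ≤ m →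
    ∑ (suc l) (convolutionCoeff k′ l m s) ≡ binom (m ∸ s + k′) k′ * binom (l + m) l
  ∑-convolutionCoeff k′ l m {s} s<k′ s≤m = begin
    ∑ (suc l) (convolutionCoeff k′ l m s)
      ≡⟨ ∑-cong (suc l) (convolutionCoeff≡expansionTerm k′ l m s<k′ s≤m) ⟩
    expansion (k′ ∸ s) l s (m ∸ s)
      ≡⟨ expansion≡binomProduct (k′ ∸ s) l s (m ∸ s) ⟩
    binom (m ∸ s + (k′ ∸ s + s)) (k′ ∸ s + s) * binom (m ∸ s + (l + s)) l
      ≡⟨ cong₂ (λ x y → binom (m ∸ s + x) x * binom y l) (m∸n+n≡m (<⇒≤ s<k′)) m∸s+[l+s]≡l+m ⟩
    binom (m ∸ s + k′) k′ * binom (l + m) l ∎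
    where
    m∸s+[l+s]≡l+m : m ∸ s + (l + s) ≡ l + m
    m∸s+[l+s]≡l+m = begin
      m ∸ s + (l + s) ≡⟨ cong (m ∸ s +_) (+-comm l s) ⟩
      m ∸ s + (s + l) ≡⟨ +-assoc (m ∸ s) s l ⟨
      m ∸ s + s + l   ≡⟨ cong (_+ l) (m∸n+n≡m s≤m) ⟩
      m + l           ≡⟨ +-comm m l ⟩
      l + m           ∎

module ZetaTransform where

  open import Data.Nat.Base as ℕ using (ℕ; zero; suc; _≤_; _<_; _∸_; _≤ᵇ_; _<ᵇ_; s≤s)
  import Data.Nat.Properties as ℕₚ
  open import Data.Integer.Base using (ℤ; +_; -_; _+_; _-_; _*_; _^_; -1ℤ)
  open import Data.Integer.Properties
  open import Data.Integer.Tactic.RingSolver using (solve-∀)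
  open import Data.Bool.Base using (if_then_else_)
  open import Data.Bool.Properties using (if-float; if-cong; if-cong-then; if-cong-else; if-eta)
  open import Data.List.Base using (foldr; applyUpTo)
  open import Function using (_∘_; id)
  open import Relation.Nullary.Decidable using (yes; no; dec-true; dec-false)
  open import Data.Nat.Induction using (<-rec)
  open import Algebra.Properties.AbelianGroup +-0-abelianGroup using (∙-cancelˡ)
  open import Relation.Binary.PropositionalEquality
  open import Data.Nat.Combinatorics using (_C_)
  open import Defs using (Σ≤; hvec)
  open Summation +-*-commutativeSemiring
  module ℕ∑ = Summation ℕₚ.+-*-commutativeSemiring
  open Binomial
  open ≡-Reasoning

  foldr-applyUpTo : ∀ n (f : ℕ → ℕ) (g : ℕ → ℤ) →
                    foldr (λ j acc → g j + acc) (+ 0) (applyUpTo f n) ≡ ∑ n (g ∘ f)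
  foldr-applyUpTo zero    f g = refl
  foldr-applyUpTo (suc n) f g = cong (_+_ (g (f 0))) (foldr-applyUpTo n (f ∘ suc) g)

  Σ≤≡∑ : ∀ m (g : ℕ → ℤ) → Σ≤ m g ≡ ∑ (suc m) g
  Σ≤≡∑ m = foldr-applyUpTo (suc m) id

  +-∑ : ∀ n (f : ℕ → ℕ) → + ℕ∑.∑ n f ≡ ∑ n (λ i → + f i)
  +-∑ zero    f = refl
  +-∑ (suc n) f = trans (pos-+ (f 0) _) (cong (_+_ (+ f 0)) (+-∑ n (f ∘ suc)))

  neg-distrib-∑ : ∀ n (f : ℕ → ℤ) → - ∑ n f ≡ ∑ n (λ i → - f i)
  neg-distrib-∑ zero    f = refl
  neg-distrib-∑ (suc n) f = trans (neg-distrib-+ (f 0) _) (cong (_+_ (- f 0)) (neg-distrib-∑ n (f ∘ suc)))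

  sign : ℕ → ℤ
  sign t = -1ℤ ^ t

  -- the coefficient of xᴹ in (1 − x)ᴺ / (1 − x)ᴷ⁺¹
  alternatingSum : ℕ → ℕ → ℕ → ℤ
  alternatingSum K N M = ∑ (suc M) (λ t → sign t * + (binom N t ℕ.* binom (M ∸ t ℕ.+ K) K))

  alternatingSum-zero : ∀ K N → alternatingSum K N 0 ≡ + 1
  alternatingSum-zero K N = begin
    sign 0 * + (1 ℕ.* binom K K) + + 0 ≡⟨ +-identityʳ _ ⟩
    sign 0 * + (1 ℕ.* binom K K)       ≡⟨ *-identityˡ _ ⟩
    + (1 ℕ.* binom K K)                ≡⟨ cong (λ n → + (1 ℕ.* n)) (binom-diag K) ⟩
    + 1                                ∎

  sign-suc : ∀ t x → sign (suc t) * x ≡ - (sign t * x)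
  sign-suc t x = trans (*-assoc -1ℤ (sign t) x) (-1*i≡-i (sign t * x))

  alternatingSum-pascal : ∀ K N M →
    alternatingSum K (suc N) (suc M) ≡ alternatingSum K N (suc M) - alternatingSum K N M
  alternatingSum-pascal K N M = begin
    t₀ + ∑ (suc M) (λ t → sign (suc t) * + ((binom N t ℕ.+ binom N (suc t)) ℕ.* X t))
      ≡⟨ cong (_+_ t₀) (trans (∑-cong (suc M) split) (∑-distrib-+ (suc M) lower upper)) ⟩
    t₀ + (∑ (suc M) lower + ∑ (suc M) upper)
      ≡⟨ regroup t₀ (∑ (suc M) lower) (∑ (suc M) upper) ⟩
    alternatingSum K N (suc M) + ∑ (suc M) lower
      ≡⟨ cong (_+_ (alternatingSum K N (suc M))) (∑-cong (suc M) (λ t → sign-suc t (+ (binom N t ℕ.* X t)))) ⟩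
    alternatingSum K N (suc M) + ∑ (suc M) (λ t → - (sign t * + (binom N t ℕ.* X t)))
      ≡⟨ cong (_+_ (alternatingSum K N (suc M))) (neg-distrib-∑ (suc M) (λ t → sign t * + (binom N t ℕ.* X t))) ⟨
    alternatingSum K N (suc M) - alternatingSum K N M ∎
    where
    t₀ = sign 0 * + (1 ℕ.* binom (suc M ℕ.+ K) K)
    X = λ t → binom (M ∸ t ℕ.+ K) K
    lower = λ t → sign (suc t) * + (binom N t ℕ.* X t)
    upper = λ t → sign (suc t) * + (binom N (suc t) ℕ.* X t)
    split : ∀ t → sign (suc t) * + ((binom N t ℕ.+ binom N (suc t)) ℕ.* X t) ≡ lower t + upper t
    split t = trans (cong (λ n → sign (suc t) * + n) (ℕₚ.*-distribʳ-+ (X t) (binom N t) _))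
                    (trans (cong (sign (suc t) *_) (pos-+ (binom N t ℕ.* X t) _)) (*-distribˡ-+ (sign (suc t)) _ _))
    regroup : ∀ x y z → x + (y + z) ≡ (x + z) + y
    regroup = solve-∀

  -- (1 − x)ᴺ / (1 − x)ᴺ⁺ᵖ⁺¹ = 1 / (1 − x)ᵖ⁺¹
  alternatingSum≡binom : ∀ N p M → alternatingSum (N ℕ.+ p) N M ≡ + binom (M ℕ.+ p) p
  alternatingSum≡binom zero    p M = begin
    alternatingSum p 0 M
      ≡⟨ ∑-head M (λ t → sign t * + (binom 0 t ℕ.* binom (M ∸ t ℕ.+ p) p)) (λ {i} _ → *-zeroʳ (sign (suc i))) ⟩
    sign 0 * + (1 ℕ.* binom (M ℕ.+ p) p) ≡⟨ *-identityˡ _ ⟩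
    + (1 ℕ.* binom (M ℕ.+ p) p)          ≡⟨ cong +_ (ℕₚ.*-identityˡ _) ⟩
    + binom (M ℕ.+ p) p                  ∎
  alternatingSum≡binom (suc N) p zero    =
    trans (alternatingSum-zero (suc N ℕ.+ p) (suc N)) (cong +_ (sym (binom-diag p)))
  alternatingSum≡binom (suc N) p (suc M) = begin
    alternatingSum (suc N ℕ.+ p) (suc N) (suc M)
      ≡⟨ cong (λ K → alternatingSum K (suc N) (suc M)) (sym (ℕₚ.+-suc N p)) ⟩
    alternatingSum (N ℕ.+ suc p) (suc N) (suc M)
      ≡⟨ alternatingSum-pascal (N ℕ.+ suc p) N M ⟩
    alternatingSum (N ℕ.+ suc p) N (suc M) - alternatingSum (N ℕ.+ suc p) N M
      ≡⟨ cong₂ _-_ (alternatingSum≡binom N (suc p) (suc M)) (alternatingSum≡binom N (suc p) M) ⟩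
    + (binom (M ℕ.+ suc p) p ℕ.+ binom (M ℕ.+ suc p) (suc p)) - + binom (M ℕ.+ suc p) (suc p)
      ≡⟨ cong (_- + binom (M ℕ.+ suc p) (suc p)) (pos-+ (binom (M ℕ.+ suc p) p) _) ⟩
    + binom (M ℕ.+ suc p) p + + binom (M ℕ.+ suc p) (suc p) - + binom (M ℕ.+ suc p) (suc p)
      ≡⟨ cancel (+ binom (M ℕ.+ suc p) p) (+ binom (M ℕ.+ suc p) (suc p)) ⟩
    + binom (M ℕ.+ suc p) p
      ≡⟨ cong (λ n → + binom n p) (ℕₚ.+-suc M p) ⟩
    + binom (suc M ℕ.+ p) p ∎
    where
    cancel : ∀ x y → x + y - y ≡ x
    cancel = solve-∀

  hCoeff : ℕ → ℕ → ℕ → ℤ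
  hCoeff n s i = if s ≤ᵇ n then (if i ≤ᵇ s then sign (s ∸ i) * + binom (n ∸ i) (n ∸ s) else + 0) else + 0

  hCoeff-below : ∀ n {s i} → s < i → hCoeff n s i ≡ + 0
  hCoeff-below n {s} {i} s<i =
    trans (if-cong-then (s ≤ᵇ n) (if-cong (dec-false (i ℕₚ.≤? s) (ℕₚ.<⇒≱ s<i)))) (if-eta (s ≤ᵇ n))

  hCoeff-above : ∀ {n s} i → n < s → hCoeff n s i ≡ + 0
  hCoeff-above {n} {s} i n<s = if-cong (dec-false (s ℕₚ.≤? n) (ℕₚ.<⇒≱ n<s))

  hCoeff-within : ∀ {n s i} → i ≤ s → s ≤ n → hCoeff n s i ≡ sign (s ∸ i) * + binom (n ∸ i) (n ∸ s)
  hCoeff-within {n} {s} {i} i≤s s≤n =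
    trans (if-cong (dec-true (s ℕₚ.≤? n) s≤n)) (if-cong (dec-true (i ℕₚ.≤? s) i≤s))

  hCoeff-diagonalShift : ∀ {n i} t → i ≤ n → hCoeff n (i ℕ.+ t) i ≡ sign t * + binom (n ∸ i) t
  hCoeff-diagonalShift {n} {i} t i≤n with t ℕₚ.≤? n ∸ i
  ... | yes t≤n∸i = begin
    hCoeff n (i ℕ.+ t) i
      ≡⟨ hCoeff-within (ℕₚ.m≤m+n i t) (ℕₚ.≤-trans (ℕₚ.+-monoʳ-≤ i t≤n∸i) (ℕₚ.≤-reflexive (ℕₚ.m+[n∸m]≡n i≤n))) ⟩
    sign (i ℕ.+ t ∸ i) * + binom (n ∸ i) (n ∸ (i ℕ.+ t))
      ≡⟨ cong₂ (λ r c → sign r * + binom (n ∸ i) c) (ℕₚ.m+n∸m≡n i t) (sym (ℕₚ.∸-+-assoc n i t)) ⟩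
    sign t * + binom (n ∸ i) (n ∸ i ∸ t)
      ≡⟨ cong (λ b → sign t * + b) (binom-sym t≤n∸i) ⟩
    sign t * + binom (n ∸ i) t ∎
  ... | no  t≰n∸i = begin
    hCoeff n (i ℕ.+ t) i       ≡⟨ hCoeff-above i n<i+t ⟩
    + 0                        ≡⟨ *-zeroʳ (sign t) ⟨
    sign t * + 0               ≡⟨ cong (λ b → sign t * + b) (binom-< (ℕₚ.≰⇒> t≰n∸i)) ⟨
    sign t * + binom (n ∸ i) t ∎
    where
    n<i+t : n < i ℕ.+ t
    n<i+t = ℕₚ.≤-trans (s≤s (ℕₚ.≤-reflexive (sym (ℕₚ.m+[n∸m]≡n i≤n))))
                       (ℕₚ.≤-trans (ℕₚ.≤-reflexive (sym (ℕₚ.+-suc i (n ∸ i)))) (ℕₚ.+-monoʳ-≤ i (ℕₚ.≰⇒> t≰n∸i)))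

  hvec≡∑hCoeff : ∀ n f s → hvec n f s ≡ ∑ (suc n) (λ i → hCoeff n s i * + f i)
  hvec≡∑hCoeff n f s with s ℕₚ.≤? n
  ... | yes s≤n = begin
    hvec n f s
      ≡⟨ if-cong (dec-true (s ℕₚ.≤? n) s≤n) ⟩
    Σ≤ s (λ i → sign (s ∸ i) * + ((n ∸ i) C (n ∸ s)) * + f i)
      ≡⟨ Σ≤≡∑ s (λ i → sign (s ∸ i) * + ((n ∸ i) C (n ∸ s)) * + f i) ⟩
    ∑ (suc s) (λ i → sign (s ∸ i) * + ((n ∸ i) C (n ∸ s)) * + f i)
      ≡⟨ ∑-cong< (suc s) (λ {i} i<1+s → cong (_* + f i)
           (trans (cong (λ b → sign (s ∸ i) * + b) (C≡binom (n ∸ i) (n ∸ s)))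
                  (sym (hCoeff-within (ℕₚ.≤-pred i<1+s) s≤n)))) ⟩
    ∑ (suc s) term
      ≡⟨ ∑-extend (suc s) (n ∸ s) term (λ {t} _ → trans (cong (_* + f (suc s ℕ.+ t)) (hCoeff-below n (s≤s (ℕₚ.m≤m+n s t)))) refl) ⟨
    ∑ (suc s ℕ.+ (n ∸ s)) term
      ≡⟨ cong (λ r → ∑ (suc r) term) (ℕₚ.m+[n∸m]≡n s≤n) ⟩
    ∑ (suc n) term ∎
    where term = λ i → hCoeff n s i * + f i
  ... | no  s≰n = begin
    hvec n f s ≡⟨ if-cong (dec-false (s ℕₚ.≤? n) s≰n) ⟩
    + 0        ≡⟨ ∑-zero (suc n) (λ {i} _ → cong (_* + f i) (hCoeff-above i (ℕₚ.≰⇒> s≰n))) ⟨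
    ∑ (suc n) (λ i → hCoeff n s i * + f i) ∎

  -- the coefficient of tᵐ in a(t) / (1 − t)ᴷ⁺¹
  zetaTransform : ℕ → (ℕ → ℤ) → ℕ → ℤ
  zetaTransform K a m = ∑ (suc m) (λ s → + binom (m ∸ s ℕ.+ K) K * a s)

  zetaTransform-hCoeff : ∀ n m {i} → i ≤ n →
    zetaTransform (suc n) (λ s → hCoeff n s i) m ≡ + binom (suc m) (suc i)
  zetaTransform-hCoeff n m {i} i≤n with i ℕₚ.≤? m
  ... | no  i≰m = begin
    ∑ (suc m) w
      ≡⟨ ∑-zero (suc m) (λ {s} s<1+m → trans (cong (_*_ (W s)) (hCoeff-below n (ℕₚ.<-≤-trans s<1+m (ℕₚ.≰⇒> i≰m))))
                                            (*-zeroʳ (W s))) ⟩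
    + 0
      ≡⟨ cong +_ (binom-< (s≤s (ℕₚ.≰⇒> i≰m))) ⟨
    + binom (suc m) (suc i) ∎
    where
    W = λ s → + binom (m ∸ s ℕ.+ suc n) (suc n)
    w = λ s → W s * hCoeff n s i
  ... | yes i≤m = begin
    ∑ (suc m) w
      ≡⟨ cong (λ r → ∑ r w) (trans (ℕₚ.+-suc i M) (cong suc (ℕₚ.m+[n∸m]≡n i≤m))) ⟨
    ∑ (i ℕ.+ suc M) w
      ≡⟨ ∑-dropInit i (suc M) w (λ {s} s<i → trans (cong (_*_ (W s)) (hCoeff-below n s<i)) (*-zeroʳ (W s))) ⟩
    ∑ (suc M) (λ t → w (i ℕ.+ t))
      ≡⟨ ∑-cong (suc M) shifted ⟩
    alternatingSum (suc n) (n ∸ i) M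
      ≡⟨ cong (λ K → alternatingSum K (n ∸ i) M) n∸i+1+i≡1+n ⟨
    alternatingSum (n ∸ i ℕ.+ suc i) (n ∸ i) M
      ≡⟨ alternatingSum≡binom (n ∸ i) (suc i) M ⟩
    + binom (M ℕ.+ suc i) (suc i)
      ≡⟨ cong (λ r → + binom r (suc i)) (trans (ℕₚ.+-suc M i) (cong suc (ℕₚ.m∸n+n≡m i≤m))) ⟩
    + binom (suc m) (suc i) ∎
    where
    M = m ∸ i
    W = λ s → + binom (m ∸ s ℕ.+ suc n) (suc n)
    w = λ s → W s * hCoeff n s i
    n∸i+1+i≡1+n : n ∸ i ℕ.+ suc i ≡ suc n
    n∸i+1+i≡1+n = trans (ℕₚ.+-suc (n ∸ i) i) (cong suc (ℕₚ.m∸n+n≡m i≤n))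
    shifted : ∀ t → w (i ℕ.+ t) ≡ sign t * + (binom (n ∸ i) t ℕ.* binom (M ∸ t ℕ.+ suc n) (suc n))
    shifted t = begin
      W (i ℕ.+ t) * hCoeff n (i ℕ.+ t) i
        ≡⟨ cong₂ (λ r h → + binom (r ℕ.+ suc n) (suc n) * h) (sym (ℕₚ.∸-+-assoc m i t)) (hCoeff-diagonalShift t i≤n) ⟩
      + binom (M ∸ t ℕ.+ suc n) (suc n) * (sign t * + binom (n ∸ i) t)
        ≡⟨ regroup (+ binom (M ∸ t ℕ.+ suc n) (suc n)) (sign t) (+ binom (n ∸ i) t) ⟩
      sign t * (+ binom (n ∸ i) t * + binom (M ∸ t ℕ.+ suc n) (suc n))
        ≡⟨ cong (_*_ (sign t)) (pos-* (binom (n ∸ i) t) _) ⟨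
      sign t * + (binom (n ∸ i) t ℕ.* binom (M ∸ t ℕ.+ suc n) (suc n)) ∎
      where
      regroup : ∀ x s y → x * (s * y) ≡ s * (y * x)
      regroup = solve-∀

  zetaTransform-hvec : ∀ n (f : ℕ → ℕ) → (∀ {i} → n < i → f i ≡ 0) → ∀ m →
    zetaTransform (suc n) (hvec n f) m ≡ + ℕ∑.∑ (suc m) (λ i → binom (suc m) (suc i) ℕ.* f i)
  zetaTransform-hvec n f f-vanishes m = begin
    ∑ (suc m) (λ s → W s * hvec n f s)
      ≡⟨ ∑-cong (suc m) (λ s → trans (cong (_*_ (W s)) (hvec≡∑hCoeff n f s))
                                     (*-distribˡ-∑ (suc n) (W s) (λ i → hCoeff n s i * + f i))) ⟩
    ∑ (suc m) (λ s → ∑ (suc n) (λ i → W s * (hCoeff n s i * + f i)))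
      ≡⟨ ∑-comm (suc m) (suc n) (λ s i → W s * (hCoeff n s i * + f i)) ⟩
    ∑ (suc n) (λ i → ∑ (suc m) (λ s → W s * (hCoeff n s i * + f i)))
      ≡⟨ ∑-cong (suc n) (λ i → trans (∑-cong (suc m) (λ s → sym (*-assoc (W s) (hCoeff n s i) (+ f i))))
                                     (sym (*-distribʳ-∑ (suc m) (+ f i) (λ s → W s * hCoeff n s i)))) ⟩
    ∑ (suc n) (λ i → zetaTransform (suc n) (λ s → hCoeff n s i) m * + f i)
      ≡⟨ ∑-cong< (suc n) (λ {i} i<1+n → trans (cong (_* + f i) (zetaTransform-hCoeff n m (ℕₚ.≤-pred i<1+n)))
                                               (sym (pos-* (binom (suc m) (suc i)) (f i)))) ⟩
    ∑ (suc n) (λ i → + g i)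
      ≡⟨ +-∑ (suc n) g ⟨
    + ℕ∑.∑ (suc n) g
      ≡⟨ cong +_ (ℕ∑.∑-extend (suc n) (suc m) g g-beyond-n) ⟨
    + ℕ∑.∑ (suc n ℕ.+ suc m) g
      ≡⟨ cong (λ r → + ℕ∑.∑ r g) (ℕₚ.+-comm (suc n) (suc m)) ⟩
    + ℕ∑.∑ (suc m ℕ.+ suc n) g
      ≡⟨ cong +_ (ℕ∑.∑-extend (suc m) (suc n) g g-beyond-m) ⟩
    + ℕ∑.∑ (suc m) g ∎
    where
    W = λ s → + binom (m ∸ s ℕ.+ suc n) (suc n)
    g = λ i → binom (suc m) (suc i) ℕ.* f i
    g-beyond-n : ∀ {t} → t < suc m → g (suc n ℕ.+ t) ≡ 0
    g-beyond-n {t} _ = trans (cong (binom (suc m) (suc (suc n ℕ.+ t)) ℕ.*_) (f-vanishes (s≤s (ℕₚ.m≤m+n n t))))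
                             (ℕₚ.*-zeroʳ (binom (suc m) (suc (suc n ℕ.+ t))))
    g-beyond-m : ∀ {t} → t < suc n → g (suc m ℕ.+ t) ≡ 0
    g-beyond-m {t} _ = cong (ℕ._* f (suc m ℕ.+ t)) (binom-< (s≤s (s≤s (ℕₚ.m≤m+n m t))))

  zetaTransform-injective : ∀ K {a b : ℕ → ℤ} → (∀ m → zetaTransform K a m ≡ zetaTransform K b m) →
                            ∀ s → a s ≡ b s
  zetaTransform-injective K {a} {b} a≈b = <-rec (λ s → a s ≡ b s) step
    where
    W : ℕ → ℕ → ℤ
    W m s = + binom (m ∸ s ℕ.+ K) K
    W-diag : ∀ m → W m m ≡ + 1
    W-diag m = trans (cong (λ r → + binom (r ℕ.+ K) K) (ℕₚ.n∸n≡0 m)) (cong +_ (binom-diag K))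
    -- the transform is unitriangular: zetaTransform K a m = a m + (terms with a s, s < m)
    step : ∀ m → (∀ {s} → s < m → a s ≡ b s) → a m ≡ b m
    step m IH = begin
      a m           ≡⟨ trans (cong (_* a m) (W-diag m)) (*-identityˡ (a m)) ⟨
      W m m * a m   ≡⟨ ∙-cancelˡ (∑ m (λ s → W m s * a s)) _ _ (begin
        ∑ m (λ s → W m s * a s) + W m m * a m ≡⟨ ∑-init-last m (λ s → W m s * a s) ⟨
        zetaTransform K a m                     ≡⟨ a≈b m ⟩
        zetaTransform K b m                     ≡⟨ ∑-init-last m (λ s → W m s * b s) ⟩
        ∑ m (λ s → W m s * b s) + W m m * b m ≡⟨ cong (_+ W m m * b m) (∑-cong< m (λ {s} s<m → cong (W m s *_) (sym (IH s<m)))) ⟩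
        ∑ m (λ s → W m s * a s) + W m m * b m ∎) ⟩
      W m m * b m   ≡⟨ trans (cong (_* b m) (W-diag m)) (*-identityˡ (b m)) ⟩
      b m           ∎

  -- The right-hand side of the theorem, with k′ = k − λₛ and l = λₛ.
  hConvolution : ℕ → ℕ → (ℕ → ℤ) → ℕ → ℤ
  hConvolution k′ l a i =
    Σ≤ l (λ j → if j ≤ᵇ i then + ((k′ ℕ.+ j ∸ i) C j) * + ((i ℕ.+ l ∸ j) C (l ∸ j)) * a (i ∸ j) else + 0)

  -- Exchanging the sums over i and j and substituting i = j + s collects the coefficient of each a s.
  zetaTransform-hConvolution-byColumns : ∀ k′ l (a : ℕ → ℤ) m →
    zetaTransform (k′ ℕ.+ l) (hConvolution k′ l a) m ≡ ∑ (suc m) (λ s → + ℕ∑.∑ (suc l) (convolutionCoeff k′ l m s) * a s)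
  zetaTransform-hConvolution-byColumns k′ l a m = begin
    ∑ (suc m) (λ i → W i * hConvolution k′ l a i)
      ≡⟨ ∑-cong (suc m) (λ i → cong (_*_ (W i)) (trans (Σ≤≡∑ l (G i))
                                                        (∑-cong (suc l) (λ j → if-cong-then (j ≤ᵇ i) {y = + 0} (C→binom i j))))) ⟩
    ∑ (suc m) (λ i → W i * ∑ (suc l) (λ j → if j ≤ᵇ i then H i j else + 0))
      ≡⟨ ∑-cong (suc m) (λ i → trans (*-distribˡ-∑ (suc l) (W i) (λ j → if j ≤ᵇ i then H i j else + 0))
                                     (∑-cong (suc l) (λ j → *-if (j ≤ᵇ i) (W i) (H i j)))) ⟩
    ∑ (suc m) (λ i → ∑ (suc l) (λ j → if j ≤ᵇ i then W i * H i j else + 0))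
      ≡⟨ ∑-comm (suc m) (suc l) (λ i j → if j ≤ᵇ i then W i * H i j else + 0) ⟩
    ∑ (suc l) (λ j → ∑ (suc m) (λ i → if j ≤ᵇ i then W i * H i j else + 0))
      ≡⟨ ∑-cong (suc l) (λ j → ∑-shift (suc m) j (λ i → W i * H i j)) ⟩
    ∑ (suc l) (λ j → ∑ (suc m) (λ s → T j s))
      ≡⟨ ∑-comm (suc l) (suc m) T ⟩
    ∑ (suc m) (λ s → ∑ (suc l) (λ j → T j s))
      ≡⟨ ∑-cong (suc m) column ⟩
    ∑ (suc m) (λ s → + ℕ∑.∑ (suc l) (convolutionCoeff k′ l m s) * a s) ∎
    where
    K = k′ ℕ.+ l
    W = λ i → + binom (m ∸ i ℕ.+ K) K
    X = λ i j → binom (k′ ℕ.+ j ∸ i) j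
    Y = λ i j → binom (i ℕ.+ l ∸ j) (l ∸ j)
    G = λ i j → if j ≤ᵇ i then + ((k′ ℕ.+ j ∸ i) C j) * + ((i ℕ.+ l ∸ j) C (l ∸ j)) * a (i ∸ j) else + 0
    H = λ i j → + X i j * + Y i j * a (i ∸ j)
    T = λ j s → if j ℕ.+ s <ᵇ suc m then W (j ℕ.+ s) * H (j ℕ.+ s) j else + 0

    C→binom : ∀ i j → + ((k′ ℕ.+ j ∸ i) C j) * + ((i ℕ.+ l ∸ j) C (l ∸ j)) * a (i ∸ j) ≡ H i j
    C→binom i j = cong₂ (λ x y → + x * + y * a (i ∸ j)) (C≡binom (k′ ℕ.+ j ∸ i) j) (C≡binom (i ℕ.+ l ∸ j) (l ∸ j))

    *-if : ∀ b x y → x * (if b then y else + 0) ≡ (if b then x * y else + 0)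
    *-if b x y = trans (if-float (_*_ x) b) (if-cong-else b (*-zeroʳ x))

    T≡coeff*a : ∀ s j → T j s ≡ + convolutionCoeff k′ l m s j * a s
    T≡coeff*a s j = begin
      T j s
        ≡⟨ if-cong-then b (cong (λ r → W i * (+ X i j * + Y i j * a r)) (ℕₚ.m+n∸m≡n j s)) ⟩
      (if b then W i * (+ X i j * + Y i j * a s) else + 0)
        ≡⟨ if-cong-then b (regroup (W i) (+ X i j) (+ Y i j) (a s)) ⟩
      (if b then W i * (+ X i j * + Y i j) * a s else + 0)
        ≡⟨ if-cong-then b (cong (_* a s) (trans (pos-* (binom (m ∸ i ℕ.+ K) K) _) (cong (_*_ (W i)) (pos-* (X i j) (Y i j))))) ⟨
      (if b then + (binom (m ∸ i ℕ.+ K) K ℕ.* (X i j ℕ.* Y i j)) * a s else + 0)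
        ≡⟨ if-float (_* a s) b ⟨
      (if b then + (binom (m ∸ i ℕ.+ K) K ℕ.* (X i j ℕ.* Y i j)) else + 0) * a s
        ≡⟨ cong (_* a s) (if-float +_ b) ⟨
      + convolutionCoeff k′ l m s j * a s ∎
      where
      i = j ℕ.+ s
      b = j ℕ.+ s <ᵇ suc m
      regroup : ∀ w x y z → w * (x * y * z) ≡ w * (x * y) * z
      regroup = solve-∀

    column : ∀ s → ∑ (suc l) (λ j → T j s) ≡ + ℕ∑.∑ (suc l) (convolutionCoeff k′ l m s) * a s
    column s = begin
      ∑ (suc l) (λ j → T j s)                                ≡⟨ ∑-cong (suc l) (T≡coeff*a s) ⟩
      ∑ (suc l) (λ j → + convolutionCoeff k′ l m s j * a s)  ≡⟨ *-distribʳ-∑ (suc l) (a s) (λ j → + convolutionCoeff k′ l m s j) ⟨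
      ∑ (suc l) (λ j → + convolutionCoeff k′ l m s j) * a s  ≡⟨ cong (_* a s) (+-∑ (suc l) (convolutionCoeff k′ l m s)) ⟨
      + ℕ∑.∑ (suc l) (convolutionCoeff k′ l m s) * a s       ∎

  zetaTransform-hConvolution : ∀ k′ l (a : ℕ → ℤ) → (∀ {s} → k′ ≤ s → a s ≡ + 0) → ∀ m →
    zetaTransform (k′ ℕ.+ l) (hConvolution k′ l a) m ≡ + binom (l ℕ.+ m) l * zetaTransform k′ a m
  zetaTransform-hConvolution k′ l a a-vanishes m = begin
    zetaTransform (k′ ℕ.+ l) (hConvolution k′ l a) m
      ≡⟨ zetaTransform-hConvolution-byColumns k′ l a m ⟩
    ∑ (suc m) (λ s → + ℕ∑.∑ (suc l) (convolutionCoeff k′ l m s) * a s)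
      ≡⟨ ∑-cong< (suc m) (λ s<1+m → column (ℕₚ.≤-pred s<1+m)) ⟩
    ∑ (suc m) (λ s → + binom (l ℕ.+ m) l * (W′ s * a s))
      ≡⟨ *-distribˡ-∑ (suc m) (+ binom (l ℕ.+ m) l) (λ s → W′ s * a s) ⟨
    + binom (l ℕ.+ m) l * zetaTransform k′ a m ∎
    where
    W′ = λ s → + binom (m ∸ s ℕ.+ k′) k′
    column : ∀ {s} → s ≤ m → + ℕ∑.∑ (suc l) (convolutionCoeff k′ l m s) * a s ≡ + binom (l ℕ.+ m) l * (W′ s * a s)
    column {s} s≤m with s ℕₚ.<? k′
    ... | yes s<k′ = begin
      + ℕ∑.∑ (suc l) (convolutionCoeff k′ l m s) * a s         ≡⟨ cong (λ r → + r * a s) (∑-convolutionCoeff k′ l m s<k′ s≤m) ⟩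
      + (binom (m ∸ s ℕ.+ k′) k′ ℕ.* binom (l ℕ.+ m) l) * a s ≡⟨ cong (_* a s) (pos-* (binom (m ∸ s ℕ.+ k′) k′) (binom (l ℕ.+ m) l)) ⟩
      W′ s * + binom (l ℕ.+ m) l * a s                         ≡⟨ regroup (W′ s) (+ binom (l ℕ.+ m) l) (a s) ⟩
      + binom (l ℕ.+ m) l * (W′ s * a s)                       ∎
      where
      regroup : ∀ x y z → x * y * z ≡ y * (x * z)
      regroup = solve-∀
    ... | no  s≮k′ = begin
      + ℕ∑.∑ (suc l) (convolutionCoeff k′ l m s) * a s ≡⟨ cong (_*_ (+ ℕ∑.∑ (suc l) (convolutionCoeff k′ l m s))) a≡0 ⟩
      + ℕ∑.∑ (suc l) (convolutionCoeff k′ l m s) * + 0 ≡⟨ *-zeroʳ (+ ℕ∑.∑ (suc l) (convolutionCoeff k′ l m s)) ⟩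
      + 0                                              ≡⟨ trans (cong (λ r → + binom (l ℕ.+ m) l * (W′ s * r)) a≡0)
                                                                (trans (cong (_*_ (+ binom (l ℕ.+ m) l)) (*-zeroʳ (W′ s))) (*-zeroʳ (+ binom (l ℕ.+ m) l))) ⟨
      + binom (l ℕ.+ m) l * (W′ s * a s)               ∎
      where
      a≡0 : a s ≡ + 0
      a≡0 = a-vanishes (ℕₚ.≮⇒≥ s≮k′)

module BooleanFilter where

  open import Data.Bool.Base using (Bool; true; false; _∧_; not; if_then_else_)
  open import Data.Bool.Properties using (T?; if-cong)
  open import Data.Nat.Base using (ℕ; _+_)
  open import Data.Nat.Properties using (+-assoc; +-commutativeSemigroup)
  open import Data.Nat.ListAction using (sum)
  open import Data.List.Base using (List; []; _∷_; _++_; map; concatMap; filterᵇ; length)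
  open import Data.List.Properties using (filter-++; length-++; length-map)
  open import Data.List.Relation.Unary.All as All using (All; []; _∷_)
  open import Function using (_∘_)
  open import Relation.Binary.PropositionalEquality
  open ≡-Reasoning

  private variable
    A B : Set
    x : A
    xs : List A
    p q : A → Bool

  filterᵇ-∷ : ∀ (p : A → Bool) x xs → filterᵇ p (x ∷ xs) ≡ (if p x then x ∷ filterᵇ p xs else filterᵇ p xs)
  filterᵇ-∷ p x xs with p x
  ... | true  = refl
  ... | false = refl

  filterᵇ-accept : ∀ (p : A → Bool) xs → p x ≡ true → filterᵇ p (x ∷ xs) ≡ x ∷ filterᵇ p xs
  filterᵇ-accept p xs px≡true = trans (filterᵇ-∷ p _ xs) (if-cong px≡true)

  filterᵇ-reject : ∀ (p : A → Bool) xs → p x ≡ false → filterᵇ p (x ∷ xs) ≡ filterᵇ p xs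
  filterᵇ-reject p xs px≡false = trans (filterᵇ-∷ p _ xs) (if-cong px≡false)

  filterᵇ-cong : All (λ x → p x ≡ q x) xs → filterᵇ p xs ≡ filterᵇ q xs
  filterᵇ-cong {p = p} {q = q} {xs = []}     []           = refl
  filterᵇ-cong {p = p} {q = q} {xs = x ∷ xs} (px≡qx ∷ eqs) = begin
    filterᵇ p (x ∷ xs)                                  ≡⟨ filterᵇ-∷ p x xs ⟩
    (if p x then x ∷ filterᵇ p xs else filterᵇ p xs)    ≡⟨ cong₂ (λ b ys → if b then x ∷ ys else ys) px≡qx (filterᵇ-cong eqs) ⟩
    (if q x then x ∷ filterᵇ q xs else filterᵇ q xs)    ≡⟨ filterᵇ-∷ q x xs ⟨
    filterᵇ q (x ∷ xs)                                  ∎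

  filterᵇ-none : ∀ (p : A → Bool) {xs} → All (λ x → p x ≡ false) xs → filterᵇ p xs ≡ []
  filterᵇ-none p               []           = refl
  filterᵇ-none p {xs = _ ∷ xs} (px≡f ∷ pxs) = trans (filterᵇ-reject p xs px≡f) (filterᵇ-none p pxs)

  filterᵇ-all : ∀ (p : A → Bool) {xs} → All (λ x → p x ≡ true) xs → filterᵇ p xs ≡ xs
  filterᵇ-all p               []           = refl
  filterᵇ-all p {xs = x ∷ xs} (px≡t ∷ pxs) = trans (filterᵇ-accept p xs px≡t) (cong (x ∷_) (filterᵇ-all p pxs))

  filterᵇ-filterᵇ : ∀ (p q : A → Bool) xs → filterᵇ p (filterᵇ q xs) ≡ filterᵇ (λ x → q x ∧ p x) xs
  filterᵇ-filterᵇ p q []       = refl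
  filterᵇ-filterᵇ p q (x ∷ xs) = begin
    filterᵇ p (filterᵇ q (x ∷ xs))                                  ≡⟨ cong (filterᵇ p) (filterᵇ-∷ q x xs) ⟩
    filterᵇ p (if q x then x ∷ filterᵇ q xs else filterᵇ q xs)      ≡⟨ byCase (q x) ⟩
    (if q x ∧ p x then x ∷ filterᵇ q∧p xs else filterᵇ q∧p xs)      ≡⟨ filterᵇ-∷ q∧p x xs ⟨
    filterᵇ q∧p (x ∷ xs)                                            ∎
    where
    q∧p = λ x → q x ∧ p x
    byCase : ∀ b → filterᵇ p (if b then x ∷ filterᵇ q xs else filterᵇ q xs)
                 ≡ (if b ∧ p x then x ∷ filterᵇ q∧p xs else filterᵇ q∧p xs)
    byCase true  = trans (filterᵇ-∷ p x _) (cong (λ ys → if p x then x ∷ ys else ys) (filterᵇ-filterᵇ p q xs))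
    byCase false = filterᵇ-filterᵇ p q xs

  filterᵇ-map : ∀ (p : B → Bool) (f : A → B) xs → filterᵇ p (map f xs) ≡ map f (filterᵇ (p ∘ f) xs)
  filterᵇ-map p f []       = refl
  filterᵇ-map p f (x ∷ xs) with p (f x)
  ... | true  = cong (f x ∷_) (filterᵇ-map p f xs)
  ... | false = filterᵇ-map p f xs

  filterᵇ-concatMap : ∀ (p : B → Bool) (f : A → List B) xs →
                      filterᵇ p (concatMap f xs) ≡ concatMap (filterᵇ p ∘ f) xs
  filterᵇ-concatMap p f []       = refl
  filterᵇ-concatMap p f (x ∷ xs) =
    trans (filter-++ (T? ∘ p) (f x) (concatMap f xs)) (cong (filterᵇ p (f x) ++_) (filterᵇ-concatMap p f xs))

  all-filterᵇ : ∀ (p : A → Bool) xs → All (λ x → p x ≡ true) (filterᵇ p xs)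
  all-filterᵇ p []       = []
  all-filterᵇ p (x ∷ xs) with p x in px
  ... | true  = px ∷ all-filterᵇ p xs
  ... | false = all-filterᵇ p xs

  count : (A → Bool) → List A → ℕ
  count p xs = length (filterᵇ p xs)

  count-++ : ∀ (p : A → Bool) xs ys → count p (xs ++ ys) ≡ count p xs + count p ys
  count-++ p xs ys = trans (cong length (filter-++ (T? ∘ p) xs ys)) (length-++ (filterᵇ p xs))

  count-map : ∀ (p : B → Bool) (f : A → B) xs → count p (map f xs) ≡ count (p ∘ f) xs
  count-map p f xs = trans (cong length (filterᵇ-map p f xs)) (length-map f (filterᵇ (p ∘ f) xs))

  count-cong : (∀ x → p x ≡ q x) → ∀ xs → count p xs ≡ count q xs
  count-cong p≗q xs = cong length (filterᵇ-cong (All.universal p≗q xs))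

  count-false : ∀ (xs : List A) → count (λ _ → false) xs ≡ 0
  count-false xs = cong length (filterᵇ-none (λ _ → false) (All.universal (λ _ → refl) xs))

  sum-filterᵇ : ∀ {A : Set} (g : A → ℕ) (p : A → Bool) xs →
                sum (map g xs) ≡ sum (map g (filterᵇ p xs)) + sum (map g (filterᵇ (not ∘ p) xs))
  sum-filterᵇ g p []       = refl
  sum-filterᵇ g p (x ∷ xs) = begin
    g x + sum (map g xs)
      ≡⟨ byCase (p x) ⟩
    sum (map g (if p x then x ∷ filterᵇ p xs else filterᵇ p xs))
      + sum (map g (if not (p x) then x ∷ filterᵇ (not ∘ p) xs else filterᵇ (not ∘ p) xs))
      ≡⟨ cong₂ (λ l l′ → sum (map g l) + sum (map g l′)) (filterᵇ-∷ p x xs) (filterᵇ-∷ (not ∘ p) x xs) ⟨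
    sum (map g (filterᵇ p (x ∷ xs))) + sum (map g (filterᵇ (not ∘ p) (x ∷ xs))) ∎
    where
    open import Algebra.Properties.CommutativeSemigroup +-commutativeSemigroup using (x∙yz≈y∙xz)
    byCase : ∀ b → g x + sum (map g xs)
                 ≡ sum (map g (if b then x ∷ filterᵇ p xs else filterᵇ p xs))
                   + sum (map g (if not b then x ∷ filterᵇ (not ∘ p) xs else filterᵇ (not ∘ p) xs))
    byCase true  = trans (cong (g x +_) (sum-filterᵇ g p xs)) (sym (+-assoc (g x) _ _))
    byCase false = trans (cong (g x +_) (sum-filterᵇ g p xs)) (x∙yz≈y∙xz (g x) (sum (map g (filterᵇ p xs))) _)

module Chains where

  open import Data.Bool.Base using (Bool; true; false; _∧_; _∨_; not; if_then_else_)
  open import Data.Bool.Properties using (∧-assoc; ∧-zeroʳ; ∧-inverseʳ; ∧-identityʳ; ∨-identityʳ)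
  open import Data.Nat.Base using (ℕ; suc; _+_; _≡ᵇ_)
  open import Data.List.Base using (List; []; _∷_; _++_; map; filterᵇ; length)
  open import Data.List.Properties using (map-++; map-∘; map-cong-local; length-map)
  open import Data.Nat.ListAction using (sum)
  open import Data.List.Relation.Unary.All as All using (All; []; _∷_)
  open import Data.List.Relation.Unary.AllPairs using (AllPairs; []; _∷_)
  open import Function using (_∘_)
  open import Relation.Binary.PropositionalEquality
  open ≡-Reasoning
  open import Defs
  open BooleanFilter

  chains : List (List ℕ) → ℕ → ℕ
  chains L i = count (λ σ → isChainᵇ σ ∧ (length σ ≡ᵇ i)) (sublists L)

  fK≡chains : ∀ μ i → fK μ i ≡ chains (properPart μ) i
  fK≡chains μ i = cong length (filterᵇ-filterᵇ (λ σ → length σ ≡ᵇ i) isChainᵇ (sublists (properPart μ)))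

  chains-zero : ∀ L → chains L 0 ≡ 1
  chains-zero []       = refl
  chains-zero (x ∷ xs) = begin
    count P (map (x ∷_) (sublists xs) ++ sublists xs)    ≡⟨ count-++ P (map (x ∷_) (sublists xs)) (sublists xs) ⟩
    count P (map (x ∷_) (sublists xs)) + chains xs 0     ≡⟨ cong (_+ chains xs 0) (count-map P (x ∷_) (sublists xs)) ⟩
    count (P ∘ (x ∷_)) (sublists xs) + chains xs 0       ≡⟨ cong (_+ chains xs 0) (count-cong (λ σ → ∧-zeroʳ (isChainᵇ (x ∷ σ))) (sublists xs)) ⟩
    count (λ _ → false) (sublists xs) + chains xs 0      ≡⟨ cong₂ _+_ (count-false (sublists xs)) (chains-zero xs) ⟩
    1                                                    ∎
    where P = λ σ → isChainᵇ σ ∧ (length σ ≡ᵇ 0)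

  count-sublists-allᵇ : ∀ (q : List ℕ → Bool) (r : List (List ℕ) → Bool) xs →
    count (λ σ → allᵇ q σ ∧ r σ) (sublists xs) ≡ count r (sublists (filterᵇ q xs))
  count-sublists-allᵇ q r []       with r []
  ... | true  = refl
  ... | false = refl
  count-sublists-allᵇ q r (y ∷ ys) = begin
    count F (map (y ∷_) (sublists ys) ++ sublists ys)
      ≡⟨ count-++ F (map (y ∷_) (sublists ys)) (sublists ys) ⟩
    count F (map (y ∷_) (sublists ys)) + count F (sublists ys)
      ≡⟨ cong₂ _+_ (count-map F (y ∷_) (sublists ys)) (count-sublists-allᵇ q r ys) ⟩
    count (F ∘ (y ∷_)) (sublists ys) + count r (sublists (filterᵇ q ys))
      ≡⟨ byCase (q y) refl ⟩
    count r (sublists (if q y then y ∷ filterᵇ q ys else filterᵇ q ys))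
      ≡⟨ cong (count r ∘ sublists) (filterᵇ-∷ q y ys) ⟨
    count r (sublists (filterᵇ q (y ∷ ys))) ∎
    where
    F = λ σ → allᵇ q σ ∧ r σ
    byCase : ∀ b → q y ≡ b → count (F ∘ (y ∷_)) (sublists ys) + count r (sublists (filterᵇ q ys))
                             ≡ count r (sublists (if b then y ∷ filterᵇ q ys else filterᵇ q ys))
    byCase true  qy≡true  = begin
      count (F ∘ (y ∷_)) (sublists ys) + count r (sublists (filterᵇ q ys))
        ≡⟨ cong (_+ _) (count-cong (λ σ → cong (λ b → (b ∧ allᵇ q σ) ∧ r (y ∷ σ)) qy≡true) (sublists ys)) ⟩
      count (λ σ → allᵇ q σ ∧ r (y ∷ σ)) (sublists ys) + count r (sublists (filterᵇ q ys))
        ≡⟨ cong (_+ _) (count-sublists-allᵇ q (r ∘ (y ∷_)) ys) ⟩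
      count (r ∘ (y ∷_)) (sublists (filterᵇ q ys)) + count r (sublists (filterᵇ q ys))
        ≡⟨ cong (_+ _) (count-map r (y ∷_) (sublists (filterᵇ q ys))) ⟨
      count r (map (y ∷_) (sublists (filterᵇ q ys))) + count r (sublists (filterᵇ q ys))
        ≡⟨ count-++ r (map (y ∷_) (sublists (filterᵇ q ys))) (sublists (filterᵇ q ys)) ⟨
      count r (sublists (y ∷ filterᵇ q ys)) ∎
    byCase false qy≡false = cong (_+ _) (trans (count-cong (λ σ → cong (λ b → (b ∧ allᵇ q σ) ∧ r (y ∷ σ)) qy≡false) (sublists ys))
                                               (count-false (sublists ys)))

  chains-∷ : ∀ x xs i → chains (x ∷ xs) (suc i) ≡ chains (filterᵇ (comparableᵇ x) xs) i + chains xs (suc i)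
  chains-∷ x xs i = begin
    count P (map (x ∷_) (sublists xs) ++ sublists xs)
      ≡⟨ count-++ P (map (x ∷_) (sublists xs)) (sublists xs) ⟩
    count P (map (x ∷_) (sublists xs)) + chains xs (suc i)
      ≡⟨ cong (_+ chains xs (suc i)) (count-map P (x ∷_) (sublists xs)) ⟩
    count (P ∘ (x ∷_)) (sublists xs) + chains xs (suc i)
      ≡⟨ cong (_+ chains xs (suc i)) (count-cong (λ σ → ∧-assoc (allᵇ (comparableᵇ x) σ) (isChainᵇ σ) _) (sublists xs)) ⟩
    count (λ σ → allᵇ (comparableᵇ x) σ ∧ (isChainᵇ σ ∧ (length σ ≡ᵇ i))) (sublists xs) + chains xs (suc i)
      ≡⟨ cong (_+ chains xs (suc i)) (count-sublists-allᵇ (comparableᵇ x) (λ σ → isChainᵇ σ ∧ (length σ ≡ᵇ i)) xs) ⟩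
    chains (filterᵇ (comparableᵇ x) xs) i + chains xs (suc i) ∎
    where P = λ σ → isChainᵇ σ ∧ (length σ ≡ᵇ suc i)

  -- L lists distinct elements along a linear extension of the componentwise order.
  LinearlyOrdered : List (List ℕ) → Set
  LinearlyOrdered = AllPairs (λ x y → leqᵇ y x ≡ false)

  ltᵇ : List ℕ → List ℕ → Bool
  ltᵇ x y = leqᵇ x y ∧ not (leqᵇ y x)

  -- Classify the (i+1)-chains by their least element x; the rest is an i-chain above x.
  chains-suc : ∀ {L} → LinearlyOrdered L → ∀ i →
               chains L (suc i) ≡ sum (map (λ x → chains (filterᵇ (ltᵇ x) L) i) L)
  chains-suc []                            i = refl
  chains-suc {x ∷ xs} (xs≰x ∷ xs-ordered) i = begin
    chains (x ∷ xs) (suc i)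
      ≡⟨ chains-∷ x xs i ⟩
    chains (filterᵇ (comparableᵇ x) xs) i + chains xs (suc i)
      ≡⟨ cong₂ _+_ (cong (λ l → chains l i) comparable≡above) (chains-suc xs-ordered i) ⟩
    chains (filterᵇ (ltᵇ x) (x ∷ xs)) i + sum (map (λ y → chains (filterᵇ (ltᵇ y) xs) i) xs)
      ≡⟨ cong (λ s → chains (filterᵇ (ltᵇ x) (x ∷ xs)) i + sum s) (map-cong-local (All.map x-not-above xs≰x)) ⟩
    sum (map (λ y → chains (filterᵇ (ltᵇ y) (x ∷ xs)) i) (x ∷ xs)) ∎
    where
    comparable≡above : filterᵇ (comparableᵇ x) xs ≡ filterᵇ (ltᵇ x) (x ∷ xs)
    comparable≡above = trans (filterᵇ-cong (All.map (λ {y} y≰x → ∨-false (leqᵇ x y) y≰x) xs≰x))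
                             (sym (filterᵇ-reject (ltᵇ x) xs (∧-inverseʳ (leqᵇ x x))))
      where
      ∨-false : ∀ a {b} → b ≡ false → (a ∨ b) ≡ (a ∧ not b)
      ∨-false a refl = trans (∨-identityʳ a) (sym (∧-identityʳ a))
    x-not-above : ∀ {y} → leqᵇ y x ≡ false → chains (filterᵇ (ltᵇ y) xs) i ≡ chains (filterᵇ (ltᵇ y) (x ∷ xs)) i
    x-not-above {y} y≰x = cong (λ l → chains l i) (sym (filterᵇ-reject (ltᵇ y) xs (cong (_∧ not (leqᵇ x y)) y≰x)))

  sublists-map : ∀ {A B : Set} (g : A → B) xs → sublists (map g xs) ≡ map (map g) (sublists xs)
  sublists-map g []       = refl
  sublists-map g (x ∷ xs) = begin
    map (g x ∷_) (sublists (map g xs)) ++ sublists (map g xs)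
      ≡⟨ cong (λ S → map (g x ∷_) S ++ S) (sublists-map g xs) ⟩
    map (g x ∷_) (map (map g) (sublists xs)) ++ map (map g) (sublists xs)
      ≡⟨ cong (_++ map (map g) (sublists xs)) (trans (sym (map-∘ (sublists xs))) (map-∘ (sublists xs))) ⟩
    map (map g) (map (x ∷_) (sublists xs)) ++ map (map g) (sublists xs)
      ≡⟨ map-++ (map g) (map (x ∷_) (sublists xs)) (sublists xs) ⟨
    map (map g) (map (x ∷_) (sublists xs) ++ sublists xs) ∎

  chains-map : ∀ (g : List ℕ → List ℕ) → (∀ a b → leqᵇ (g a) (g b) ≡ leqᵇ a b) →
               ∀ L i → chains (map g L) i ≡ chains L i
  chains-map g g-embedding L i = begin
    count P (sublists (map g L))      ≡⟨ cong (count P) (sublists-map g L) ⟩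
    count P (map (map g) (sublists L)) ≡⟨ count-map P (map g) (sublists L) ⟩
    count (P ∘ map g) (sublists L)     ≡⟨ count-cong (λ σ → cong₂ (λ c n → c ∧ (n ≡ᵇ i)) (isChain-map σ) (length-map g σ)) (sublists L) ⟩
    chains L i                         ∎
    where
    P = λ σ → isChainᵇ σ ∧ (length σ ≡ᵇ i)
    allComparable-map : ∀ x σ → allᵇ (comparableᵇ (g x)) (map g σ) ≡ allᵇ (comparableᵇ x) σ
    allComparable-map x []      = refl
    allComparable-map x (y ∷ σ) =
      cong₂ _∧_ (cong₂ _∨_ (g-embedding x y) (g-embedding y x)) (allComparable-map x σ)
    isChain-map : ∀ σ → isChainᵇ (map g σ) ≡ isChainᵇ σ
    isChain-map []      = refl
    isChain-map (x ∷ σ) = cong₂ _∧_ (allComparable-map x σ) (isChain-map σ)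

module Box where

  open import Data.Bool.Base using (Bool; true; false; _∧_; not; if_then_else_)
  open import Data.Nat.Base using (ℕ; zero; suc; _+_; _∸_; _≤_; _<_; _≤ᵇ_; z≤n; s≤s)
  open import Data.Nat.Properties
  open import Data.List.Base using (List; []; _∷_; _++_; map; concatMap; filterᵇ; upTo; applyUpTo)
  open import Data.List.Properties using (map-∘; map-applyUpTo; concatMap-cong; concatMap-map; map-concatMap; filter-++)
  open import Data.Bool.Properties using (T?; if-float; ∧-zeroʳ; ∧-comm; ¬-not; ∧-commutativeMonoid)
  open import Function.Bundles using (mk⇔)
  open import Data.Nat.ListAction using (sum)
  open import Data.Product using (_×_; _,_)
  open import Algebra.Bundles using (CommutativeMonoid)
  open import Algebra.Properties.CommutativeSemigroup (CommutativeMonoid.commutativeSemigroup ∧-commutativeMonoid)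
    using (x∙yz≈y∙zx)
  open import Data.List.Relation.Unary.All as All using (All; []; _∷_)
  import Data.List.Relation.Unary.All.Properties as All
  open import Data.List.Relation.Unary.AllPairs as AllPairs using (AllPairs; []; _∷_)
  import Data.List.Relation.Unary.AllPairs.Properties as AllPairs
  open import Data.List.Relation.Binary.Pointwise using (Pointwise; []; _∷_)
  open import Function using (_∘_; id)
  open import Relation.Nullary.Decidable using (dec-true; dec-false; does-⇔)
  open import Relation.Binary.PropositionalEquality
  open ≡-Reasoning
  open import Defs
  open BooleanFilter
  open Chains using (LinearlyOrdered; ltᵇ)

  InBox : List ℕ → List ℕ → Set
  InBox = Pointwise _≤_

  infixl 6 _⊕_ _⊖_

  -- Translation by x.
  _⊕_ : List ℕ → List ℕ → List ℕ
  []       ⊕ z        = z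
  (x ∷ xs) ⊕ []       = []
  (x ∷ xs) ⊕ (z ∷ zs) = x + z ∷ xs ⊕ zs

  _⊖_ : List ℕ → List ℕ → List ℕ
  []       ⊖ _        = []
  (m ∷ ms) ⊖ []       = m ∷ ms
  (m ∷ ms) ⊖ (x ∷ xs) = m ∸ x ∷ ms ⊖ xs

  ≤ᵇ-refl : ∀ a → (a ≤ᵇ a) ≡ true
  ≤ᵇ-refl a = dec-true (a ≤? a) ≤-refl

  box-linearlyOrdered : ∀ μ → LinearlyOrdered (box μ)
  box-linearlyOrdered []       = [] ∷ []
  box-linearlyOrdered (m ∷ ms) = AllPairs.concat⁺
    (All.map⁺ (All.universal withinBlock (upTo (suc m))))
    (AllPairs.map⁺ (AllPairs.applyUpTo⁺₁ id (suc m) (λ a<b _ → acrossBlocks a<b)))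
    where
    withinBlock : ∀ a → LinearlyOrdered (map (a ∷_) (box ms))
    withinBlock a = AllPairs.map⁺ (AllPairs.map (λ {y} {x} y≰x → trans (cong (_∧ leqᵇ x y) (≤ᵇ-refl a)) y≰x)
                                                (box-linearlyOrdered ms))
    acrossBlocks : ∀ {a b} → a < b → All (λ x → All (λ y → leqᵇ y x ≡ false) (map (b ∷_) (box ms))) (map (a ∷_) (box ms))
    acrossBlocks {a} {b} a<b = All.map⁺ (All.universal (λ x → All.map⁺ (All.universal (λ y →
      cong (_∧ leqᵇ y x) (dec-false (b ≤? a) (<⇒≱ a<b))) (box ms))) (box ms))

  box-inBox : ∀ μ → All (λ x → InBox x μ) (box μ)
  box-inBox []       = [] ∷ []
  box-inBox (m ∷ ms) = All.concat⁺ (All.map⁺ (All.applyUpTo⁺₁ id (suc m) (λ a<1+m →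
    All.map⁺ (All.map (λ x≤ms → ≤-pred a<1+m ∷ x≤ms) (box-inBox ms)))))

  applyUpTo-++ : ∀ {A : Set} (f : ℕ → A) m n → applyUpTo f (m + n) ≡ applyUpTo f m ++ applyUpTo (f ∘ (m +_)) n
  applyUpTo-++ f zero    n = refl
  applyUpTo-++ f (suc m) n = cong (f 0 ∷_) (applyUpTo-++ (f ∘ suc) m n)

  filterᵇ-upTo : ∀ {a m} → a ≤ m → filterᵇ (a ≤ᵇ_) (upTo (suc m)) ≡ map (a +_) (upTo (suc (m ∸ a)))
  filterᵇ-upTo {a} {m} a≤m = begin
    filterᵇ (a ≤ᵇ_) (upTo (suc m))
      ≡⟨ cong (filterᵇ (a ≤ᵇ_) ∘ upTo) (trans (+-suc a (m ∸ a)) (cong suc (m+[n∸m]≡n a≤m))) ⟨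
    filterᵇ (a ≤ᵇ_) (applyUpTo id (a + suc (m ∸ a)))
      ≡⟨ cong (filterᵇ (a ≤ᵇ_)) (applyUpTo-++ id a (suc (m ∸ a))) ⟩
    filterᵇ (a ≤ᵇ_) (upTo a ++ applyUpTo (a +_) (suc (m ∸ a)))
      ≡⟨ filter-++ (T? ∘ (a ≤ᵇ_)) (upTo a) _ ⟩
    filterᵇ (a ≤ᵇ_) (upTo a) ++ filterᵇ (a ≤ᵇ_) (applyUpTo (a +_) (suc (m ∸ a)))
      ≡⟨ cong₂ _++_ (filterᵇ-none (a ≤ᵇ_) (All.applyUpTo⁺₁ id a (λ {i} i<a → dec-false (a ≤? i) (<⇒≱ i<a))))
                    (filterᵇ-all (a ≤ᵇ_) (All.applyUpTo⁺₂ (a +_) (suc (m ∸ a)) (λ t → dec-true (a ≤? a + t) (m≤m+n a t)))) ⟩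
    applyUpTo (a +_) (suc (m ∸ a))
      ≡⟨ map-applyUpTo id (a +_) (suc (m ∸ a)) ⟨
    map (a +_) (upTo (suc (m ∸ a))) ∎

  filterᵇ-∧-const : ∀ {A : Set} c (p : A → Bool) xs → filterᵇ (λ y → c ∧ p y) xs ≡ (if c then filterᵇ p xs else [])
  filterᵇ-∧-const true  p xs = refl
  filterᵇ-∧-const false p xs = filterᵇ-none (λ _ → false) (All.universal (λ _ → refl) xs)

  concatMap-if : ∀ {A B : Set} (q : A → Bool) (g : A → List B) xs →
                 concatMap (λ a → if q a then g a else []) xs ≡ concatMap g (filterᵇ q xs)
  concatMap-if q g []       = refl
  concatMap-if q g (a ∷ as) = trans (byCase (q a)) (cong (concatMap g) (sym (filterᵇ-∷ q a as)))
    where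
    byCase : ∀ b → (if b then g a else []) ++ concatMap (λ a → if q a then g a else []) as
                   ≡ concatMap g (if b then a ∷ filterᵇ q as else filterᵇ q as)
    byCase true  = cong (g a ++_) (concatMap-if q g as)
    byCase false = concatMap-if q g as

  box-upSet : ∀ {x μ} → InBox x μ → filterᵇ (leqᵇ x) (box μ) ≡ map (x ⊕_) (box (μ ⊖ x))
  box-upSet []                                  = refl
  box-upSet {a ∷ xs} {m ∷ ms} (a≤m ∷ xs≤ms) = begin
    filterᵇ (leqᵇ (a ∷ xs)) (concatMap block (upTo (suc m)))
      ≡⟨ filterᵇ-concatMap (leqᵇ (a ∷ xs)) block (upTo (suc m)) ⟩
    concatMap (filterᵇ (leqᵇ (a ∷ xs)) ∘ block) (upTo (suc m))
      ≡⟨ concatMap-cong filterBlock (upTo (suc m)) ⟩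
    concatMap (λ c → if a ≤ᵇ c then map (c ∷_) (filterᵇ (leqᵇ xs) (box ms)) else []) (upTo (suc m))
      ≡⟨ concatMap-if (a ≤ᵇ_) (λ c → map (c ∷_) (filterᵇ (leqᵇ xs) (box ms))) (upTo (suc m)) ⟩
    concatMap (λ c → map (c ∷_) (filterᵇ (leqᵇ xs) (box ms))) (filterᵇ (a ≤ᵇ_) (upTo (suc m)))
      ≡⟨ cong (concatMap (λ c → map (c ∷_) (filterᵇ (leqᵇ xs) (box ms)))) (filterᵇ-upTo a≤m) ⟩
    concatMap (λ c → map (c ∷_) (filterᵇ (leqᵇ xs) (box ms))) (map (a +_) (upTo (suc (m ∸ a))))
      ≡⟨ concatMap-map (λ c → map (c ∷_) (filterᵇ (leqᵇ xs) (box ms))) (a +_) (upTo (suc (m ∸ a))) ⟩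
    concatMap (λ c → map (a + c ∷_) (filterᵇ (leqᵇ xs) (box ms))) (upTo (suc (m ∸ a)))
      ≡⟨ concatMap-cong (λ c → trans (cong (map (a + c ∷_)) (box-upSet xs≤ms)) (trans (sym (map-∘ _)) (map-∘ _))) (upTo (suc (m ∸ a))) ⟩
    concatMap (λ c → map ((a ∷ xs) ⊕_) (map (c ∷_) (box (ms ⊖ xs)))) (upTo (suc (m ∸ a)))
      ≡⟨ map-concatMap ((a ∷ xs) ⊕_) (λ c → map (c ∷_) (box (ms ⊖ xs))) (upTo (suc (m ∸ a))) ⟨
    map ((a ∷ xs) ⊕_) (box ((m ∷ ms) ⊖ (a ∷ xs))) ∎
    where
    block = λ c → map (c ∷_) (box ms)
    filterBlock : ∀ c → filterᵇ (leqᵇ (a ∷ xs)) (block c) ≡ (if a ≤ᵇ c then map (c ∷_) (filterᵇ (leqᵇ xs) (box ms)) else [])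
    filterBlock c = begin
      filterᵇ (leqᵇ (a ∷ xs)) (map (c ∷_) (box ms))
        ≡⟨ filterᵇ-map (leqᵇ (a ∷ xs)) (c ∷_) (box ms) ⟩
      map (c ∷_) (filterᵇ (λ y → (a ≤ᵇ c) ∧ leqᵇ xs y) (box ms))
        ≡⟨ cong (map (c ∷_)) (filterᵇ-∧-const (a ≤ᵇ c) (leqᵇ xs) (box ms)) ⟩
      map (c ∷_) (if a ≤ᵇ c then filterᵇ (leqᵇ xs) (box ms) else [])
        ≡⟨ if-float (map (c ∷_)) (a ≤ᵇ c) ⟩
      (if a ≤ᵇ c then map (c ∷_) (filterᵇ (leqᵇ xs) (box ms)) else []) ∎

  ⊕-leq : ∀ x a b → leqᵇ (x ⊕ a) (x ⊕ b) ≡ leqᵇ a b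
  ⊕-leq []       a        b        = refl
  ⊕-leq (x ∷ xs) []       []       = refl
  ⊕-leq (x ∷ xs) []       (b ∷ bs) = refl
  ⊕-leq (x ∷ xs) (a ∷ as) []       = refl
  ⊕-leq (x ∷ xs) (a ∷ as) (b ∷ bs) = cong₂ _∧_
    (does-⇔ (mk⇔ (+-cancelˡ-≤ x a b) (+-monoʳ-≤ x)) (x + a ≤? x + b) (a ≤? b))
    (⊕-leq xs as bs)

  ⊕-leq-self : ∀ {x μ z} → InBox x μ → InBox z (μ ⊖ x) → leqᵇ (x ⊕ z) x ≡ eqᵇ z (zeros (μ ⊖ x))
  ⊕-leq-self []                   []                   = refl
  ⊕-leq-self {a ∷ _} {z = zero  ∷ _} (_ ∷ xs≤ms) (_ ∷ zs≤) =
    cong₂ _∧_ (dec-true (a + 0 ≤? a) (≤-reflexive (+-identityʳ a))) (⊕-leq-self xs≤ms zs≤)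
  ⊕-leq-self {a ∷ xs} {z = suc z ∷ zs} (_ ∷ _) (_ ∷ _) =
    cong (_∧ leqᵇ (xs ⊕ zs) xs) (dec-false (a + suc z ≤? a) (<⇒≱ (≤-trans (s≤s (m≤m+n a z)) (≤-reflexive (sym (+-suc a z))))))

  ⊕-eq-top : ∀ {x μ z} → InBox x μ → InBox z (μ ⊖ x) → eqᵇ (x ⊕ z) μ ≡ eqᵇ z (μ ⊖ x)
  ⊕-eq-top []                         []        = refl
  ⊕-eq-top {a ∷ _} {m ∷ _} {z ∷ _} (a≤m ∷ xs≤ms) (_ ∷ zs≤) = cong₂ _∧_
    (does-⇔ (mk⇔ (λ a+z≡m → trans (sym (m+n∸m≡n a z)) (cong (_∸ a) a+z≡m))
                 (λ z≡m∸a → trans (cong (a +_) z≡m∸a) (m+[n∸m]≡n a≤m)))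
            (a + z ≟ m) (z ≟ m ∸ a))
    (⊕-eq-top xs≤ms zs≤)

  ⊕-eq-bottom : ∀ {x μ z} → InBox x μ → InBox z (μ ⊖ x) →
                eqᵇ (x ⊕ z) (zeros μ) ≡ eqᵇ x (zeros μ) ∧ eqᵇ z (zeros (μ ⊖ x))
  ⊕-eq-bottom []                                            []        = refl
  ⊕-eq-bottom {zero  ∷ xs} {m ∷ ms} {zero  ∷ zs} (_ ∷ xs≤ms) (_ ∷ zs≤) = ⊕-eq-bottom xs≤ms zs≤
  ⊕-eq-bottom {zero  ∷ xs} {m ∷ ms} {suc z ∷ zs} (_ ∷ _)     (_ ∷ _)   = sym (∧-zeroʳ (eqᵇ xs (zeros ms)))
  ⊕-eq-bottom {suc a ∷ xs} {m ∷ ms} {z     ∷ zs} (_ ∷ _)     (_ ∷ _)   = refl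

  isProperᵇ : List ℕ → List ℕ → Bool
  isProperᵇ μ y = not (eqᵇ y (zeros μ)) ∧ not (eqᵇ y μ)

  properPart-strictUpSet : ∀ {x μ} → InBox x μ → filterᵇ (ltᵇ x) (properPart μ) ≡ map (x ⊕_) (properPart (μ ⊖ x))
  properPart-strictUpSet {x} {μ} x≤μ = begin
    filterᵇ (ltᵇ x) (filterᵇ (isProperᵇ μ) (box μ))
      ≡⟨ filterᵇ-filterᵇ (ltᵇ x) (isProperᵇ μ) (box μ) ⟩
    filterᵇ (λ y → isProperᵇ μ y ∧ ltᵇ x y) (box μ)
      ≡⟨ filterᵇ-cong (All.universal (λ y → x∙yz≈y∙zx (isProperᵇ μ y) (leqᵇ x y) (not (leqᵇ y x))) (box μ)) ⟩
    filterᵇ (λ y → leqᵇ x y ∧ Q y) (box μ)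
      ≡⟨ filterᵇ-filterᵇ Q (leqᵇ x) (box μ) ⟨
    filterᵇ Q (filterᵇ (leqᵇ x) (box μ))
      ≡⟨ cong (filterᵇ Q) (box-upSet x≤μ) ⟩
    filterᵇ Q (map (x ⊕_) (box μ′))
      ≡⟨ filterᵇ-map Q (x ⊕_) (box μ′) ⟩
    map (x ⊕_) (filterᵇ (Q ∘ (x ⊕_)) (box μ′))
      ≡⟨ cong (map (x ⊕_)) (filterᵇ-cong (All.map translated (box-inBox μ′))) ⟩
    map (x ⊕_) (filterᵇ (isProperᵇ μ′) (box μ′)) ∎
    where
    μ′ = μ ⊖ x
    Q = λ y → not (leqᵇ y x) ∧ isProperᵇ μ y
    translated : ∀ {z} → InBox z μ′ → Q (x ⊕ z) ≡ isProperᵇ μ′ z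
    translated {z} z≤μ′ = begin
      not (leqᵇ (x ⊕ z) x) ∧ (not (eqᵇ (x ⊕ z) (zeros μ)) ∧ not (eqᵇ (x ⊕ z) μ))
        ≡⟨ cong₂ (λ a b → not a ∧ b) (⊕-leq-self x≤μ z≤μ′)
                 (cong₂ (λ a b → not a ∧ not b) (⊕-eq-bottom x≤μ z≤μ′) (⊕-eq-top x≤μ z≤μ′)) ⟩
      not (eqᵇ z (zeros μ′)) ∧ (not (eqᵇ x (zeros μ) ∧ eqᵇ z (zeros μ′)) ∧ not (eqᵇ z μ′))
        ≡⟨ absorb (eqᵇ z (zeros μ′)) (eqᵇ x (zeros μ)) (eqᵇ z μ′) ⟩
      isProperᵇ μ′ z ∎
      where
      absorb : ∀ a b c → not a ∧ (not (b ∧ a) ∧ not c) ≡ not a ∧ not c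
      absorb true  b     c = refl
      absorb false true  c = refl
      absorb false false c = refl

  properPart-inBox : ∀ μ → All (λ x → InBox x μ × isProperᵇ μ x ≡ true) (properPart μ)
  properPart-inBox μ = All.zip (All.filter⁺ (T? ∘ isProperᵇ μ) (box-inBox μ) , all-filterᵇ (isProperᵇ μ) (box μ))

  isZeroᵇ : List ℕ → Bool
  isZeroᵇ μ = eqᵇ μ (zeros μ)

  isProperᵇ⇒≢ : ∀ {μ x} → isProperᵇ μ x ≡ true → eqᵇ x (zeros μ) ≡ false × eqᵇ x μ ≡ false
  isProperᵇ⇒≢ {μ} {x} = split (eqᵇ x (zeros μ)) (eqᵇ x μ)
    where
    split : ∀ a b → not a ∧ not b ≡ true → a ≡ false × b ≡ false
    split false false _ = refl , refl

  eqᵇ-refl : ∀ y → eqᵇ y y ≡ true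
  eqᵇ-refl []       = refl
  eqᵇ-refl (y ∷ ys) = cong₂ _∧_ (dec-true (y ≟ y) refl) (eqᵇ-refl ys)

  isZeroᵇ⇒≡zeros : ∀ {μ} → isZeroᵇ μ ≡ true → μ ≡ zeros μ
  isZeroᵇ⇒≡zeros {[]}         _      = refl
  isZeroᵇ⇒≡zeros {zero ∷ ms}  ms≡0   = cong (0 ∷_) (isZeroᵇ⇒≡zeros ms≡0)

  1≤sum⇒¬isZeroᵇ : ∀ μ → 1 ≤ sum μ → isZeroᵇ μ ≡ false
  1≤sum⇒¬isZeroᵇ μ 1≤∑μ = ¬-not (λ μ≡0 → <⇒≢ (≤-trans 1≤∑μ (≤-reflexive (∑μ≡0 μ≡0))) refl)
    where
    sum-zeros : ∀ μ → sum (zeros μ) ≡ 0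
    sum-zeros []       = refl
    sum-zeros (_ ∷ ms) = sum-zeros ms
    ∑μ≡0 : isZeroᵇ μ ≡ true → sum μ ≡ 0
    ∑μ≡0 μ≡0 = trans (cong sum (isZeroᵇ⇒≡zeros {μ} μ≡0)) (sum-zeros μ)

  ¬isZeroᵇ⇒1≤sum : ∀ {y} → isZeroᵇ y ≡ false → 1 ≤ sum y
  ¬isZeroᵇ⇒1≤sum {zero  ∷ ys} y≢0 = ¬isZeroᵇ⇒1≤sum {ys} y≢0
  ¬isZeroᵇ⇒1≤sum {suc y ∷ ys} _   = s≤s z≤n

  zeros-inBox : ∀ {x μ} → InBox x μ → zeros x ≡ zeros μ
  zeros-inBox []            = refl
  zeros-inBox (_ ∷ xs≤ms) = cong (0 ∷_) (zeros-inBox xs≤ms)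

  inBox-refl : ∀ μ → InBox μ μ
  inBox-refl []       = []
  inBox-refl (m ∷ ms) = ≤-refl ∷ inBox-refl ms

  ⊖-zeros : ∀ μ → μ ⊖ zeros μ ≡ μ
  ⊖-zeros []       = refl
  ⊖-zeros (m ∷ ms) = cong (m ∷_) (⊖-zeros ms)

  ⊖-self : ∀ μ → μ ⊖ μ ≡ zeros μ
  ⊖-self []       = refl
  ⊖-self (m ∷ ms) = cong₂ _∷_ (n∸n≡0 m) (⊖-self ms)

  ⊕-zeros : ∀ μ → μ ⊕ zeros μ ≡ μ
  ⊕-zeros []       = refl
  ⊕-zeros (m ∷ ms) = cong₂ _∷_ (+-identityʳ m) (⊕-zeros ms)

  isZeroᵇ-⊖ : ∀ {x μ} → InBox x μ → isZeroᵇ (μ ⊖ x) ≡ eqᵇ x μ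
  isZeroᵇ-⊖ []                        = refl
  isZeroᵇ-⊖ {a ∷ _} {m ∷ _} (a≤m ∷ xs≤ms) = cong₂ _∧_
    (does-⇔ (mk⇔ (λ m∸a≡0 → ≤-antisym a≤m (m∸n≡0⇒m≤n m∸a≡0)) (λ a≡m → trans (cong (m ∸_) a≡m) (n∸n≡0 m)))
            (m ∸ a ≟ 0) (a ≟ m))
    (isZeroᵇ-⊖ xs≤ms)

  sum-⊖ : ∀ {x μ} → InBox x μ → sum (μ ⊖ x) + sum x ≡ sum μ
  sum-⊖ []                        = refl
  sum-⊖ {a ∷ xs} {m ∷ ms} (a≤m ∷ xs≤ms) = begin
    (m ∸ a + sum (ms ⊖ xs)) + (a + sum xs) ≡⟨ interchange (m ∸ a) _ a _ ⟩
    (m ∸ a + a) + (sum (ms ⊖ xs) + sum xs) ≡⟨ cong₂ _+_ (m∸n+n≡m a≤m) (sum-⊖ xs≤ms) ⟩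
    m + sum ms                             ∎
    where open import Algebra.Properties.CommutativeSemigroup +-commutativeSemigroup using (interchange)

  box-zeros : ∀ μ → box (zeros μ) ≡ zeros μ ∷ []
  box-zeros []       = refl
  box-zeros (m ∷ ms) = cong (λ b → map (0 ∷_) b ++ []) (box-zeros ms)

  eqᵇ-inBox : ∀ {z μ} → InBox z μ → eqᵇ z μ ≡ leqᵇ μ z
  eqᵇ-inBox []                        = refl
  eqᵇ-inBox {a ∷ _} {m ∷ _} (a≤m ∷ zs≤ms) = cong₂ _∧_
    (does-⇔ (mk⇔ (≤-reflexive ∘ sym) (≤-antisym a≤m)) (a ≟ m) (m ≤? a))
    (eqᵇ-inBox zs≤ms)

  box-bottom : ∀ μ → filterᵇ (λ z → eqᵇ z (zeros μ)) (box μ) ≡ zeros μ ∷ []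
  box-bottom []       = refl
  box-bottom (m ∷ ms) = begin
    filterᵇ E (map (0 ∷_) (box ms) ++ concatMap block (applyUpTo suc m))
      ≡⟨ filter-++ (T? ∘ E) (map (0 ∷_) (box ms)) _ ⟩
    filterᵇ E (map (0 ∷_) (box ms)) ++ filterᵇ E (concatMap block (applyUpTo suc m))
      ≡⟨ cong₂ _++_ (trans (filterᵇ-map E (0 ∷_) (box ms)) (cong (map (0 ∷_)) (box-bottom ms)))
                    (filterᵇ-none E (All.concat⁺ (All.map⁺ (All.applyUpTo⁺₂ suc m
                      (λ _ → All.map⁺ (All.universal (λ _ → refl) (box ms))))))) ⟩
    zeros (m ∷ ms) ∷ [] ∎
    where
    E = λ z → eqᵇ z (zeros (m ∷ ms))
    block = λ c → map (c ∷_) (box ms)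

  box-top : ∀ μ → filterᵇ (λ z → eqᵇ z μ) (box μ) ≡ μ ∷ []
  box-top μ = begin
    filterᵇ (λ z → eqᵇ z μ) (box μ) ≡⟨ filterᵇ-cong (All.map eqᵇ-inBox (box-inBox μ)) ⟩
    filterᵇ (leqᵇ μ) (box μ)         ≡⟨ box-upSet (inBox-refl μ) ⟩
    map (μ ⊕_) (box (μ ⊖ μ))         ≡⟨ cong (map (μ ⊕_) ∘ box) (⊖-self μ) ⟩
    map (μ ⊕_) (box (zeros μ))       ≡⟨ cong (map (μ ⊕_)) (box-zeros μ) ⟩
    μ ⊕ zeros μ ∷ []                 ≡⟨ cong (_∷ []) (⊕-zeros μ) ⟩
    μ ∷ []                           ∎

  sum-box : ∀ μ (g : List ℕ → ℕ) → isZeroᵇ μ ≡ false →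
            sum (map g (box μ)) ≡ g (zeros μ) + (g μ + sum (map g (properPart μ)))
  sum-box μ g μ≢0 = begin
    sum (map g (box μ))
      ≡⟨ sum-filterᵇ g bottom (box μ) ⟩
    sum (map g (filterᵇ bottom (box μ))) + sum (map g nonBottom)
      ≡⟨ cong₂ _+_ (cong (sum ∘ map g) (box-bottom μ)) (sum-filterᵇ g top nonBottom) ⟩
    (g (zeros μ) + 0) + (sum (map g (filterᵇ top nonBottom)) + sum (map g (filterᵇ (not ∘ top) nonBottom)))
      ≡⟨ cong₂ (λ a l → a + (sum (map g l) + sum (map g (filterᵇ (not ∘ top) nonBottom))))
               (+-identityʳ (g (zeros μ))) topOnly ⟩
    g (zeros μ) + ((g μ + 0) + sum (map g (filterᵇ (not ∘ top) nonBottom)))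
      ≡⟨ cong₂ (λ a l → g (zeros μ) + (a + sum (map g l))) (+-identityʳ (g μ)) (filterᵇ-filterᵇ (not ∘ top) (not ∘ bottom) (box μ)) ⟩
    g (zeros μ) + (g μ + sum (map g (properPart μ))) ∎
    where
    bottom = λ y → eqᵇ y (zeros μ)
    top = λ y → eqᵇ y μ
    nonBottom = filterᵇ (not ∘ bottom) (box μ)
    topOnly : filterᵇ top nonBottom ≡ μ ∷ []
    topOnly = begin
      filterᵇ top nonBottom                                ≡⟨ filterᵇ-filterᵇ top (not ∘ bottom) (box μ) ⟩
      filterᵇ (λ y → not (bottom y) ∧ top y) (box μ)       ≡⟨ filterᵇ-cong (All.universal (λ y → ∧-comm (not (bottom y)) (top y)) (box μ)) ⟩
      filterᵇ (λ y → top y ∧ not (bottom y)) (box μ)       ≡⟨ filterᵇ-filterᵇ (not ∘ bottom) top (box μ) ⟨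
      filterᵇ (not ∘ bottom) (filterᵇ top (box μ))         ≡⟨ cong (filterᵇ (not ∘ bottom)) (box-top μ) ⟩
      filterᵇ (not ∘ bottom) (μ ∷ [])                      ≡⟨ filterᵇ-accept (not ∘ bottom) [] (cong not μ≢0) ⟩
      μ ∷ []                                               ∎

module Multichains where

  open import Data.Bool.Base using (true; false; if_then_else_)
  open import Data.Bool.Properties using (T?; if-cong)
  open import Data.Nat.Base using (ℕ; zero; suc; _+_; _*_; _∸_; _≤_; _<_)
  open import Data.Nat.Properties
  open import Data.Nat.ListAction using (sum; product)
  open import Data.Nat.ListAction.Properties using (sum-++; product-++)
  open import Data.List.Base using (List; []; _∷_; _++_; _∷ʳ_; map; concatMap; upTo; applyUpTo)
  open import Data.List.Properties using (map-cong; map-cong-local; map-++; map-∘)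
  open import Data.List.Relation.Unary.All as All using (All; []; _∷_)
  import Data.List.Relation.Unary.AllPairs.Properties as AllPairs
  open import Data.Product using (_×_; _,_; proj₁; proj₂)
  open import Function using (_∘_; id)
  open import Relation.Nullary.Negation using (contradiction)
  open import Relation.Binary.PropositionalEquality
  open ≡-Reasoning
  open import Defs
  open Summation +-*-commutativeSemiring using (∑; ∑-cong; ∑-zero; ∑-distrib-+; ∑-init-last; *-distribʳ-∑)
  open Binomial using (binom; binom-<; binom-sym; hockey-stick)
  open BooleanFilter
  open Chains
  open Box

  chainCount : List ℕ → ℕ → ℕ
  chainCount μ = chains (properPart μ)

  chainCount-suc : ∀ μ i → chainCount μ (suc i) ≡ sum (map (λ x → chainCount (μ ⊖ x) i) (properPart μ))
  chainCount-suc μ i = trans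
    (chains-suc (AllPairs.filter⁺ (T? ∘ isProperᵇ μ) (box-linearlyOrdered μ)) i)
    (cong sum (map-cong-local (All.map (λ {x} (x≤μ , _) →
      trans (cong (λ l → chains l i) (properPart-strictUpSet x≤μ)) (chains-map (x ⊕_) (⊕-leq x) (properPart (μ ⊖ x)) i))
      (properPart-inBox μ))))

  *-distribˡ-sum : ∀ {A : Set} c (f : A → ℕ) xs → c * sum (map f xs) ≡ sum (map (λ x → c * f x) xs)
  *-distribˡ-sum c f []       = *-zeroʳ c
  *-distribˡ-sum c f (x ∷ xs) = trans (*-distribˡ-+ c (f x) _) (cong (c * f x +_) (*-distribˡ-sum c f xs))

  ∑-sum-comm : ∀ {A : Set} m (h : A → ℕ → ℕ) xs →
               ∑ m (λ i → sum (map (λ x → h x i) xs)) ≡ sum (map (λ x → ∑ m (h x)) xs)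
  ∑-sum-comm m h []       = ∑-zero m (λ _ → refl)
  ∑-sum-comm m h (x ∷ xs) = trans (∑-distrib-+ m (h x) _) (cong (∑ m (h x) +_) (∑-sum-comm m h xs))

  -- The number of multichains 0̂ ≤ x₁ ≤ ⋯ ≤ x_{m−1} ≤ 1̂ in P_μ, counted by the chain of
  -- proper elements they visit: an i-chain is visited by C(m, i + 1) of them.
  multichains : List ℕ → ℕ → ℕ
  multichains μ m = if isZeroᵇ μ then 1 else ∑ m (λ i → binom m (suc i) * chainCount μ i)

  multichains-zero : ∀ μ m → isZeroᵇ μ ≡ true → multichains μ m ≡ 1
  multichains-zero μ m μ≡0 = if-cong μ≡0

  multichains-nonZero : ∀ μ m → isZeroᵇ μ ≡ false → multichains μ m ≡ ∑ m (λ i → binom m (suc i) * chainCount μ i)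
  multichains-nonZero μ m μ≢0 = if-cong μ≢0

  -- Split off the first step x₁ = x; the rest is a multichain of [x, 1̂] ≅ P_{μ − x}.
  multichains-suc : ∀ μ m → multichains μ (suc m) ≡ sum (map (λ x → multichains (μ ⊖ x) m) (box μ))
  multichains-suc μ m = byCase (isZeroᵇ μ) refl
    where
    g = λ x → multichains (μ ⊖ x) m
    F = chainCount μ
    byCase : ∀ b → isZeroᵇ μ ≡ b → multichains μ (suc m) ≡ sum (map g (box μ))
    byCase true  μ≡0 = begin
      multichains μ (suc m)       ≡⟨ multichains-zero μ (suc m) μ≡0 ⟩
      1                           ≡⟨ multichains-zero μ m μ≡0 ⟨
      multichains μ m             ≡⟨ cong (λ ν → multichains ν m) (⊖-zeros μ) ⟨
      g (zeros μ)                 ≡⟨ +-identityʳ _ ⟨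
      sum (map g (zeros μ ∷ []))  ≡⟨ cong (sum ∘ map g) (trans (cong box (isZeroᵇ⇒≡zeros {μ} μ≡0)) (box-zeros μ)) ⟨
      sum (map g (box μ))         ∎
    byCase false μ≢0 = begin
      multichains μ (suc m)
        ≡⟨ multichains-nonZero μ (suc m) μ≢0 ⟩
      ∑ (suc m) (λ i → (binom m i + binom m (suc i)) * F i)
        ≡⟨ ∑-cong (suc m) (λ i → *-distribʳ-+ (F i) (binom m i) (binom m (suc i))) ⟩
      ∑ (suc m) (λ i → binom m i * F i + binom m (suc i) * F i)
        ≡⟨ ∑-distrib-+ (suc m) (λ i → binom m i * F i) (λ i → binom m (suc i) * F i) ⟩
      ∑ (suc m) (λ i → binom m i * F i) + ∑ (suc m) (λ i → binom m (suc i) * F i)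
        ≡⟨ cong₂ _+_ firstStepProper lastStepTop ⟩
      (1 + sum (map g (properPart μ))) + multichains μ m
        ≡⟨ +-comm _ (multichains μ m) ⟩
      multichains μ m + (1 + sum (map g (properPart μ)))
        ≡⟨ cong₂ (λ a b → a + (b + sum (map g (properPart μ))))
                 (cong (λ ν → multichains ν m) (⊖-zeros μ))
                 (multichains-zero (μ ⊖ μ) m (trans (isZeroᵇ-⊖ (inBox-refl μ)) (eqᵇ-refl μ))) ⟨
      g (zeros μ) + (g μ + sum (map g (properPart μ)))
        ≡⟨ sum-box μ g μ≢0 ⟨
      sum (map g (box μ)) ∎
      where
      h = λ x i → binom m (suc i) * chainCount (μ ⊖ x) i
      firstStepProper : ∑ (suc m) (λ i → binom m i * F i) ≡ 1 + sum (map g (properPart μ))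
      firstStepProper = begin
        1 * F 0 + ∑ m (λ i → binom m (suc i) * F (suc i))
          ≡⟨ cong₂ _+_ (trans (*-identityˡ (F 0)) (chains-zero (properPart μ)))
                       (∑-cong m (λ i → trans (cong (binom m (suc i) *_) (chainCount-suc μ i))
                                              (*-distribˡ-sum (binom m (suc i)) (λ x → chainCount (μ ⊖ x) i) (properPart μ)))) ⟩
        1 + ∑ m (λ i → sum (map (λ x → h x i) (properPart μ)))
          ≡⟨ cong (1 +_) (∑-sum-comm m h (properPart μ)) ⟩
        1 + sum (map (λ x → ∑ m (h x)) (properPart μ))
          ≡⟨ cong (λ l → 1 + sum l) (map-cong-local (All.map (λ {x} (x≤μ , proper) →
               sym (multichains-nonZero (μ ⊖ x) m (trans (isZeroᵇ-⊖ x≤μ) (proj₂ (isProperᵇ⇒≢ {μ} {x} proper))))) (properPart-inBox μ))) ⟩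
        1 + sum (map g (properPart μ)) ∎
      lastStepTop : ∑ (suc m) (λ i → binom m (suc i) * F i) ≡ multichains μ m
      lastStepTop = begin
        ∑ (suc m) (λ i → binom m (suc i) * F i)
          ≡⟨ ∑-init-last m (λ i → binom m (suc i) * F i) ⟩
        ∑ m (λ i → binom m (suc i) * F i) + binom m (suc m) * F m
          ≡⟨ cong (λ b → ∑ m (λ i → binom m (suc i) * F i) + b * F m) (binom-< (n<1+n m)) ⟩
        ∑ m (λ i → binom m (suc i) * F i) + 0
          ≡⟨ +-identityʳ _ ⟩
        ∑ m (λ i → binom m (suc i) * F i)
          ≡⟨ multichains-nonZero μ m μ≢0 ⟨
        multichains μ m ∎

  sum-map-applyUpTo : ∀ (g f : ℕ → ℕ) n → sum (map g (applyUpTo f n)) ≡ ∑ n (g ∘ f)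
  sum-map-applyUpTo g f zero    = refl
  sum-map-applyUpTo g f (suc n) = cong (g (f 0) +_) (sum-map-applyUpTo g (f ∘ suc) n)

  sum-concatMap : ∀ {A B : Set} (h : B → ℕ) (G : A → List B) xs →
                  sum (map h (concatMap G xs)) ≡ sum (map (λ a → sum (map h (G a))) xs)
  sum-concatMap h G []       = refl
  sum-concatMap h G (a ∷ as) = begin
    sum (map h (G a ++ concatMap G as))               ≡⟨ cong sum (map-++ h (G a) (concatMap G as)) ⟩
    sum (map h (G a) ++ map h (concatMap G as))       ≡⟨ sum-++ (map h (G a)) _ ⟩
    sum (map h (G a)) + sum (map h (concatMap G as))  ≡⟨ cong (sum (map h (G a)) +_) (sum-concatMap h G as) ⟩
    sum (map (λ a → sum (map h (G a))) (a ∷ as))      ∎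

  -- A multichain of length m in the chain 0 < 1 < ⋯ < a is a multiset of size m drawn from a + 1 elements.
  multisetProduct : List ℕ → ℕ → ℕ
  multisetProduct μ m = product (map (λ a → binom (a + m) m) μ)

  multisetProduct-zero : ∀ μ → multisetProduct μ 0 ≡ 1
  multisetProduct-zero []       = refl
  multisetProduct-zero (a ∷ as) = trans (+-identityʳ _) (multisetProduct-zero as)

  multisetProduct-∷ʳ : ∀ μ l m → multisetProduct (μ ∷ʳ l) m ≡ multisetProduct μ m * binom (l + m) l
  multisetProduct-∷ʳ μ l m = begin
    product (map f (μ ++ l ∷ []))      ≡⟨ cong product (map-++ f μ (l ∷ [])) ⟩
    product (map f μ ++ f l ∷ [])      ≡⟨ product-++ (map f μ) (f l ∷ []) ⟩
    product (map f μ) * (f l * 1)      ≡⟨ cong (product (map f μ) *_) (trans (*-identityʳ (f l)) binom[l+m,m]≡binom[l+m,l]) ⟩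
    multisetProduct μ m * binom (l + m) l ∎
    where
    f = λ a → binom (a + m) m
    binom[l+m,m]≡binom[l+m,l] : binom (l + m) m ≡ binom (l + m) l
    binom[l+m,m]≡binom[l+m,l] = trans (cong (binom (l + m)) (sym (m+n∸m≡n l m))) (binom-sym (m≤m+n l m))

  multisetProduct-suc : ∀ μ m → sum (map (λ x → multisetProduct (μ ⊖ x) m) (box μ)) ≡ multisetProduct μ (suc m)
  multisetProduct-suc []       m = refl
  multisetProduct-suc (c ∷ cs) m = begin
    sum (map h (concatMap block (upTo (suc c))))
      ≡⟨ sum-concatMap h block (upTo (suc c)) ⟩
    sum (map (λ a → sum (map h (block a))) (upTo (suc c)))
      ≡⟨ cong sum (map-cong (λ a → trans (cong sum (sym (map-∘ (box cs))))
                                  (trans (sym (*-distribˡ-sum (binom (c ∸ a + m) m) (λ x → multisetProduct (cs ⊖ x) m) (box cs)))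
                                         (cong (binom (c ∸ a + m) m *_) (multisetProduct-suc cs m)))) (upTo (suc c))) ⟩
    sum (map (λ a → binom (c ∸ a + m) m * multisetProduct cs (suc m)) (upTo (suc c)))
      ≡⟨ sum-map-applyUpTo (λ a → binom (c ∸ a + m) m * multisetProduct cs (suc m)) id (suc c) ⟩
    ∑ (suc c) (λ a → binom (c ∸ a + m) m * multisetProduct cs (suc m))
      ≡⟨ *-distribʳ-∑ (suc c) (multisetProduct cs (suc m)) (λ a → binom (c ∸ a + m) m) ⟨
    ∑ (suc c) (λ a → binom (c ∸ a + m) m) * multisetProduct cs (suc m)
      ≡⟨ cong (_* multisetProduct cs (suc m)) (hockey-stick c m) ⟩
    multisetProduct (c ∷ cs) (suc m) ∎
    where
    h = λ x → multisetProduct ((c ∷ cs) ⊖ x) m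
    block = λ a → map (a ∷_) (box cs)

  multichains≡multisetProduct : ∀ μ m → multichains μ (suc m) ≡ multisetProduct μ m
  multichains≡multisetProduct μ zero    = byCase (isZeroᵇ μ) refl
    where
    byCase : ∀ b → isZeroᵇ μ ≡ b → multichains μ 1 ≡ multisetProduct μ 0
    byCase true  μ≡0 = trans (multichains-zero μ 1 μ≡0) (sym (multisetProduct-zero μ))
    byCase false μ≢0 = begin
      multichains μ 1               ≡⟨ multichains-nonZero μ 1 μ≢0 ⟩
      1 * chainCount μ 0 + 0        ≡⟨ trans (+-identityʳ _) (*-identityˡ _) ⟩
      chainCount μ 0                ≡⟨ chains-zero (properPart μ) ⟩
      1                             ≡⟨ multisetProduct-zero μ ⟨
      multisetProduct μ 0           ∎
  multichains≡multisetProduct μ (suc m) = begin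
    multichains μ (suc (suc m))                                      ≡⟨ multichains-suc μ (suc m) ⟩
    sum (map (λ x → multichains (μ ⊖ x) (suc m)) (box μ))           ≡⟨ cong sum (map-cong (λ x → multichains≡multisetProduct (μ ⊖ x) m) (box μ)) ⟩
    sum (map (λ x → multisetProduct (μ ⊖ x) m) (box μ))              ≡⟨ multisetProduct-suc μ m ⟩
    multisetProduct μ (suc m)                                        ∎

  -- A chain of proper elements is at most rank(1̂) − 1 = sum μ − 1 long.
  chainCount-vanishes : ∀ μ i → 1 ≤ sum μ → sum μ ≤ i → chainCount μ i ≡ 0
  chainCount-vanishes μ zero    1≤∑μ ∑μ≤0 = contradiction (≤-trans 1≤∑μ ∑μ≤0) λ ()
  chainCount-vanishes μ (suc i) 1≤∑μ ∑μ≤1+i =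
    trans (chainCount-suc μ i) (sum-zero (All.map vanishesAbove (properPart-inBox μ)))
    where
    sum-zero : ∀ {f : List ℕ → ℕ} {xs} → All (λ x → f x ≡ 0) xs → sum (map f xs) ≡ 0
    sum-zero []           = refl
    sum-zero (fx≡0 ∷ fxs) = cong₂ _+_ fx≡0 (sum-zero fxs)
    vanishesAbove : ∀ {x} → InBox x μ × isProperᵇ μ x ≡ true → chainCount (μ ⊖ x) i ≡ 0
    vanishesAbove {x} (x≤μ , proper) = chainCount-vanishes (μ ⊖ x) i 1≤∑[μ⊖x] ∑[μ⊖x]≤i
      where
      1≤∑x : 1 ≤ sum x
      1≤∑x = ¬isZeroᵇ⇒1≤sum {x} (trans (cong (eqᵇ x) (zeros-inBox x≤μ)) (proj₁ (isProperᵇ⇒≢ {μ} {x} proper)))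
      1≤∑[μ⊖x] : 1 ≤ sum (μ ⊖ x)
      1≤∑[μ⊖x] = ¬isZeroᵇ⇒1≤sum {μ ⊖ x} (trans (isZeroᵇ-⊖ x≤μ) (proj₂ (isProperᵇ⇒≢ {μ} {x} proper)))
      ∑[μ⊖x]≤i : sum (μ ⊖ x) ≤ i
      ∑[μ⊖x]≤i = ≤-pred (≤-trans (m<m+n (sum (μ ⊖ x)) 1≤∑x) (≤-trans (≤-reflexive (sum-⊖ x≤μ)) ∑μ≤1+i))

open import Defs
open import Data.Nat using (ℕ; _≤_; _+_; _∸_; _≤ᵇ_)
open import Data.Nat.Combinatorics using (_C_)
open import Data.Integer as ℤ using (ℤ; +_)
open import Data.List using (List; []; _∷_; _++_; length)
open import Data.Bool using (if_then_else_)
open import Relation.Binary.PropositionalEquality using (_≡_)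


open import Data.Nat.Base using (suc; _<_; _*_)
open import Data.Nat.Properties
  using (≤-trans; ≤-reflexive; m≤m+n; m+n∸n≡m; <⇒≱; _≤?_; m∸n+n≡m; +-comm; +-identityʳ; *-comm; +-*-commutativeSemiring)
open import Data.Nat.ListAction using (sum)
open import Data.Nat.ListAction.Properties using (sum-++)
open import Data.List.Base using (_∷ʳ_)
open import Data.List.Relation.Unary.All using (_∷_)
open import Data.Product using (_,_)
open import Data.Bool.Properties using (if-cong)
open import Data.Integer.Properties using (pos-*)
open import Relation.Nullary.Decidable using (dec-false)
open import Relation.Binary.PropositionalEquality using (sym; trans; cong; module ≡-Reasoning)
open ≡-Reasoning
open Summation +-*-commutativeSemiring using (∑; ∑-cong)
open Binomial using (binom)
open ZetaTransform
open Chains using (fK≡chains)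
open Box using (1≤sum⇒¬isZeroᵇ)
open Multichains

suc[n∸1]≡n : ∀ {n} → 1 ≤ n → suc (n ∸ 1) ≡ n
suc[n∸1]≡n {n} 1≤n = trans (+-comm 1 (n ∸ 1)) (m∸n+n≡m 1≤n)

zetaTransform-hK : ∀ μ → 1 ≤ sum μ → ∀ m → zetaTransform (sum μ) (hK μ) m ≡ + multisetProduct μ m
zetaTransform-hK μ 1≤∑μ m = begin
  zetaTransform (sum μ) (hK μ) m
    ≡⟨ cong (λ K → zetaTransform K (hK μ) m) (suc[n∸1]≡n 1≤∑μ) ⟨
  zetaTransform (suc n) (hvec n (fK μ)) m
    ≡⟨ zetaTransform-hvec n (fK μ) fK-vanishes m ⟩
  + ∑ (suc m) (λ i → binom (suc m) (suc i) * fK μ i)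
    ≡⟨ cong +_ (∑-cong (suc m) (λ i → cong (binom (suc m) (suc i) *_) (fK≡chains μ i))) ⟩
  + ∑ (suc m) (λ i → binom (suc m) (suc i) * chainCount μ i)
    ≡⟨ cong +_ (multichains-nonZero μ (suc m) (1≤sum⇒¬isZeroᵇ μ 1≤∑μ)) ⟨
  + multichains μ (suc m)
    ≡⟨ cong +_ (multichains≡multisetProduct μ m) ⟩
  + multisetProduct μ m ∎
  where
  n = sum μ ∸ 1
  fK-vanishes : ∀ {i} → n < i → fK μ i ≡ 0
  fK-vanishes {i} n<i = trans (fK≡chains μ i) (chainCount-vanishes μ i 1≤∑μ (≤-trans (≤-reflexive (sym (suc[n∸1]≡n 1≤∑μ))) n<i))

hK-vanishes : ∀ μ → 1 ≤ sum μ → ∀ {s} → sum μ ≤ s → hK μ s ≡ + 0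
hK-vanishes μ 1≤∑μ {s} ∑μ≤s =
  if-cong (dec-false (s ≤? sum μ ∸ 1) (<⇒≱ (≤-trans (≤-reflexive (suc[n∸1]≡n 1≤∑μ)) ∑μ≤s)))

sum-∷ʳ : ∀ μ l → sum (μ ∷ʳ l) ≡ sum μ + l
sum-∷ʳ μ l = trans (sum-++ μ (l ∷ [])) (cong (_+_ (sum μ)) (+-identityʳ l))

hK-∷ʳ : ∀ μ l → 1 ≤ sum μ → ∀ i → hK (μ ∷ʳ l) i ≡ hConvolution (sum μ) l (hK μ) i
hK-∷ʳ μ l 1≤∑μ = zetaTransform-injective (sum μ + l) λ m → begin
  zetaTransform (sum μ + l) (hK μ∷ʳl) m
    ≡⟨ cong (λ K → zetaTransform K (hK μ∷ʳl) m) (sum-∷ʳ μ l) ⟨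
  zetaTransform (sum μ∷ʳl) (hK μ∷ʳl) m
    ≡⟨ zetaTransform-hK μ∷ʳl (≤-trans 1≤∑μ (≤-trans (m≤m+n (sum μ) l) (≤-reflexive (sym (sum-∷ʳ μ l))))) m ⟩
  + multisetProduct μ∷ʳl m
    ≡⟨ cong +_ (multisetProduct-∷ʳ μ l m) ⟩
  + (multisetProduct μ m * binom (l + m) l)
    ≡⟨ trans (cong +_ (*-comm (multisetProduct μ m) _)) (pos-* (binom (l + m) l) _) ⟩
  + binom (l + m) l ℤ.* + multisetProduct μ m
    ≡⟨ cong (+ binom (l + m) l ℤ.*_) (zetaTransform-hK μ 1≤∑μ m) ⟨
  + binom (l + m) l ℤ.* zetaTransform (sum μ) (hK μ) m
    ≡⟨ zetaTransform-hConvolution (sum μ) l (hK μ) (hK-vanishes μ 1≤∑μ) m ⟨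
  zetaTransform (sum μ + l) (hConvolution (sum μ) l (hK μ)) m ∎
  where μ∷ʳl = μ ∷ʳ l

mainTheorem8 : (lam' : List ℕ) (ls k : ℕ) → IsPartitionOf (lam' ++ ls ∷ []) k → 1 ≤ length lam' →
    (i : ℕ) →
    hK (lam' ++ ls ∷ []) i
      ≡ Σ≤ ls (λ j → if j ≤ᵇ i
          then (+ (((k ∸ ls + j) ∸ i) C j)) ℤ.* (+ ((i + ls ∸ j) C (ls ∸ j))) ℤ.* hK lam' (i ∸ j)
          else + 0)
mainTheorem8 []            ls k _                       ()
mainTheorem8 lam'@(a ∷ as) ls k (1≤a ∷ _ , _ , ∑≡k) _ i = begin
  hK (lam' ++ ls ∷ []) i                  ≡⟨ hK-∷ʳ lam' ls (≤-trans 1≤a (m≤m+n a (sum as))) i ⟩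
  hConvolution (sum lam') ls (hK lam') i  ≡⟨ cong (λ k′ → hConvolution k′ ls (hK lam') i) ∑lam'≡k∸ls ⟩
  hConvolution (k ∸ ls) ls (hK lam') i    ∎
  where
  ∑lam'≡k∸ls : sum lam' ≡ k ∸ ls
  ∑lam'≡k∸ls = trans (sym (m+n∸n≡m (sum lam') ls)) (cong (_∸ ls) (trans (sym (sum-∷ʳ lam' ls)) ∑≡k))
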